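{- Let $\mathbb{G}=(\mathbb{V},\mathbb{E})$ be a finite simple graph with chromatic polynomial $P_{\mathbb{G}}(q)$, and let $\mathbf{m}=\{\mathrm{m}_R\}_{R\in \mathrm{C}_{\mathbb{V}}}$ be any partition scheme in $\mathbb{G}$ (as defined in the context). Then, as polynomials in $q$ (in particular for every $q\in\mathbb{N}$), $$ P_{\mathbb{G}}(q)=q^{|\mathbb{V}|}\sum_{F\in \mathcal{F}^{\mathbf{m}}_{\mathbb{G}}}\left(-\frac{1}{q}\right)^{|F|}, $$ where $\mathcal{F}^{\mathbf{m}}_{\mathbb{G}}$ is the set consisting of the empty forest together with all nonempty forests $F$ of $\mathbb{G}$ such that every non-trivial tree $\tau$ of $F$ (i.e. every connected component of $(\mathbb{V},F)$ with at least one edge) satisfies $\mathbf{m}(\tau)=\tau$, and $|F|$ denotes the number of edges of $F$.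
   Context: For $n\in\mathbb{N}$, a coloring of $\mathbb{V}$ with $q$ colors is a map $\kappa:\mathbb{V}\to\{1,\dots,q\}$; it is proper if $\kappa(x)\neq\kappa(y)$ for every edge $\{x,y\}\in\mathbb{E}$. The chromatic polynomial $P_{\mathbb{G}}(q)$ is the number of proper colorings of $\mathbb{V}$ with $q$ colors, viewed as a polynomial in $q$. For $R\subseteq\mathbb{V}$, $\mathbb{G}|_R=(R,\mathbb{E}|_R)$ is the induced subgraph, $\mathbb{E}|_R=\{\{x,y\}\subseteq R:\{x,y\}\in\mathbb{E}\}$. Let $\mathrm{C}_{\mathbb{V}}=\{R\subseteq\mathbb{V}: \mathbb{G}|_R \text{ is connected and } |R|\ge 2\}$. For $R\in\mathrm{C}_{\mathbb{V}}$, $\mathcal{C}_{\mathbb{G}|_R}$ denotes the set of connected spanning subgraphs of $\mathbb{G}|_R$ (subgraphs with vertex set $R$), and $\mathcal{T}_{\mathbb{G}|_R}\subseteq\mathcal{C}_{\mathbb{G}|_R}$ the set of spanning trees of $\mathbb{G}|_R$. A partition scheme in $\mathbb{G}|_R$ is a map $\mathrm{m}_R:\mathcal{T}_{\mathbb{G}|_R}\to\mathcal{C}_{\mathbb{G}|_R}$ such that $\tau\subseteq\mathrm{m}_R(\tau)$ (edge-set inclusion) for every $\tau\in\mathcal{T}_{\mathbb{G}|_R}$, and $\mathcal{C}_{\mathbb{G}|_R}$ is the disjoint union over $\tau\in\mathcal{T}_{\mathbb{G}|_R}$ of the intervals $[\tau,\mathrm{m}_R(\tau)]=\{g\in\mathcal{C}_{\mathbb{G}|_R}:\tau\subseteq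 g\subseteq\mathrm{m}_R(\tau)\}$. A family $\mathbf{m}=\{\mathrm{m}_R\}_{R\in\mathrm{C}_{\mathbb{V}}}$ with each $\mathrm{m}_R$ a partition scheme in $\mathbb{G}|_R$ is called a partition scheme in $\mathbb{G}$; for a tree $\tau$ that is a subgraph of $\mathbb{G}$ with at least one edge and vertex set $V_\tau$, write $\mathbf{m}(\tau)=\mathrm{m}_{V_\tau}(\tau)$. A forest of $\mathbb{G}$ is a subset $F\subseteq\mathbb{E}$ such that every connected component of $(\mathbb{V},F)$ with at least one edge is a tree; the empty set counts as a forest. -}

module Defs where

open import Data.Nat as ℕ using (ℕ; zero; suc; _≤_; _∸_)
open import Data.Bool using (Bool; true; false; _∧_; _∨_)
open import Data.Fin using (Fin; toℕ; _≟_)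
open import Data.Fin.Properties using (all?)
open import Data.Fin.Subset using (Subset; _∈_; _⊆_; _-_; ∣_∣)
open import Data.Vec using (Vec; []; _∷_; lookup; tabulate)
open import Data.List as List using (List; allFin; map; concatMap; filter; length)
open import Data.Bool.ListAction using (any)
import Data.List.Membership.Propositional as LM
open import Data.List.Relation.Unary.Unique.Propositional using (Unique)
open import Data.Integer as ℤ using (ℤ)
open import Data.Product using (Σ; ∃; _×_; _,_; proj₁; proj₂)
open import Relation.Binary.PropositionalEquality using (_≡_; _≢_)
open import Relation.Nullary using (¬_; Dec)
open import Relation.Nullary using (¬?)
open import Relation.Nullary.Decidable using (⌊_⌋)

-- Its edges are indexed by
-- Fin m; edge k is the unordered pair {src k, tgt k}, stored with
-- src k < tgt k (so no loops), and distinct indices give distinct pairs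
-- (so no multiple edges).
record Graph (n : ℕ) : Set where
  field
    m        : ℕ
    src      : Fin m → Fin n
    tgt      : Fin m → Fin n
    ordered  : ∀ k → toℕ (src k) ℕ.< toℕ (tgt k)
    distinct : ∀ k l → src k ≡ src l → tgt k ≡ tgt l → k ≡ l

module _ {n : ℕ} (G : Graph n) where
  open Graph G

  EdgeSet : Set
  EdgeSet = Subset m

  data Joins (k : Fin m) : Fin n → Fin n → Set where
    fwd : Joins k (src k) (tgt k)
    bwd : Joins k (tgt k) (src k)

  data Reach (H : EdgeSet) : Fin n → Fin n → Set where
    here : ∀ {x} → Reach H x x
    step : ∀ {x y z} (k : Fin m) → k ∈ H → Joins k x y → Reach H y z → Reach H x z

  induced : Subset n → EdgeSet
  induced R = tabulate (λ k → lookup R (src k) ∧ lookup R (tgt k))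

  SpanningSub : Subset n → EdgeSet → Set
  SpanningSub R H = H ⊆ induced R

  ConnSpanning : Subset n → EdgeSet → Set
  ConnSpanning R H = SpanningSub R H × (∀ x y → x ∈ R → y ∈ R → Reach H x y)

  Acyclic : EdgeSet → Set
  Acyclic H = ∀ k → k ∈ H → ¬ Reach (H - k) (src k) (tgt k)

  SpanningTree : Subset n → EdgeSet → Set
  SpanningTree R H = ConnSpanning R H × Acyclic H

  InC : Subset n → Set
  InC R = ConnSpanning R (induced R) × 2 ≤ ∣ R ∣

  -- mR is a partition scheme in G|_R (defined on all edge sets; only its
  -- values on spanning trees of G|_R matter)
  IsPartitionScheme : Subset n → (EdgeSet → EdgeSet) → Set
  IsPartitionScheme R mR =
      (∀ τ → SpanningTree R τ → τ ⊆ mR τ × ConnSpanning R (mR τ))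
    × (∀ g → ConnSpanning R g →
         Σ EdgeSet λ τ → SpanningTree R τ × τ ⊆ g × g ⊆ mR τ)
    × (∀ g τ τ' → ConnSpanning R g → SpanningTree R τ → SpanningTree R τ' →
         τ ⊆ g → g ⊆ mR τ → τ' ⊆ g → g ⊆ mR τ' → τ ≡ τ')

  IsPartitionSchemeG : (Subset n → EdgeSet → EdgeSet) → Set
  IsPartitionSchemeG 𝐦 = ∀ R → InC R → IsPartitionScheme R (𝐦 R)

  vertexSet : EdgeSet → Subset n
  vertexSet τ = tabulate (λ x → any (λ k → lookup τ k ∧ (⌊ src k ≟ x ⌋ ∨ ⌊ tgt k ≟ x ⌋)) (allFin m))

  -- τ is the edge set of a connected component of (V, F) having at least one edge
  Component : EdgeSet → EdgeSet → Set
  Component F τ = Σ (Fin m) λ k → k ∈ τ ×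
    (∀ l → (l ∈ τ → l ∈ F × Reach F (src k) (src l))
         × (l ∈ F × Reach F (src k) (src l) → l ∈ τ))

  InFamily : (Subset n → EdgeSet → EdgeSet) → EdgeSet → Set
  InFamily 𝐦 F = Acyclic F × (∀ τ → Component F τ → 𝐦 (vertexSet τ) τ ≡ τ)

  Proper : ∀ {q} → Vec (Fin q) n → Set
  Proper κ = ∀ k → lookup κ (src k) ≢ lookup κ (tgt k)

  proper? : ∀ {q} (κ : Vec (Fin q) n) → Dec (Proper κ)
  proper? κ = all? (λ k → ¬? (lookup κ (src k) ≟ lookup κ (tgt k)))

allVecs : (q k : ℕ) → List (Vec (Fin q) k)
allVecs q zero    = List.[ [] ]
allVecs q (suc k) = concatMap (λ c → map (c ∷_) (allVecs q k)) (allFin q)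

chromatic : ∀ {n} → Graph n → ℕ → ℕ
chromatic {n} G q = length (filter (proper? G) (allVecs q n))

sumℤ : List ℤ → ℤ
sumℤ = List.foldr ℤ._+_ ℤ.0ℤ

{-# OPTIONS --safe #-}
module Submission where

-- Expanding ∏ over the edges of (1 − [κ x = κ y]) and summing over all colourings κ gives
-- P_G(q) = Σ_{A ⊆ E} (−1)^|A| N_q(A), where N_q(A) counts the q-colourings that are constant on
-- every edge of A.  Call an edge e switchable in A if its ends lie in one component R of (V, A)
-- and e ∈ m_R(τ) ∖ τ, where [τ, m_R(τ)] is the interval of the partition scheme containing the
-- edges of A inside R.  Toggling the first switchable edge changes neither the components of A
-- (so N_q is unchanged) nor the set of switchable edges, so it is a sign-reversing involution and
-- only the edge sets without switchable edges survive.  These are exactly the forests of ℱ^𝐦_G,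
-- and for a forest F one has N_q(F) = q^(|V| − |F|), since deleting an edge of a forest
-- multiplies N_q by q.

open import Defs
open import Algebra.Definitions using (Involutive)
open import Data.Bool using (Bool; true; false; not; T; _∧_; _∨_; if_then_else_)
open import Data.Bool.Properties using (T-∧; T-∨; T-≡)
open import Data.Empty using (⊥-elim)
open import Data.Fin as Fin using (Fin; zero; suc; _≟_)
import Data.Fin.Properties as Fin
open import Data.Fin.Permutation using (Permutation′; transpose; _⟨$⟩ʳ_; _⟨$⟩ˡ_; inverseʳ; inverseˡ)
import Data.Fin.Permutation as Perm
open import Data.Fin.Subset using (Subset; _⊆_; _-_; _∩_; ∣_∣; ⊥; ⁅_⁆; Nonempty)
open import Data.Fin.Subset.Properties
  using ( _∈?_; _⊆?_; ⊆-antisym; ⊥⊆; ∉⊥; x∈p∩q⁺; x∈p∩q⁻; p─q⊆p; p─⊥≡p; x∈p∧x≢y⇒x∈p-y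
        ; x∈⁅y⁆⇒x≡y; ∣⁅x⁆∣≡1; ∣⊥∣≡0; p⊆q⇒∣p∣≤∣q∣; x∈p⇒∣p-x∣<∣p∣; nonempty?; Empty-unique )
open import Data.Integer as ℤ using (ℤ; +_; -1ℤ; 0ℤ; 1ℤ; _+_; _*_; -_) renaming (_^_ to _^ℤ_)
import Data.Integer.Properties as ℤ
open import Data.Integer.Tactic.RingSolver using (solve-∀)
open import Algebra.Properties.CommutativeSemigroup ℤ.+-commutativeSemigroup
  using () renaming (interchange to +-interchange)
open import Data.List as List using (List; []; _∷_; _++_; map; filter; length; concatMap; allFin)
import Data.List.Properties as List
open import Data.List.Relation.Unary.Unique.Propositional using (Unique)
import Data.List.Relation.Unary.Unique.Propositional.Properties as Unique
open import Data.Nat as ℕ using (ℕ; zero; suc; _∸_; _^_; _≤_; _<_; z≤n; s≤s)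
import Data.Nat.Properties as ℕ
open import Data.Product using (∃-syntax; _×_; _,_; proj₁; proj₂)
open import Data.Sum as Sum using (_⊎_; inj₁; inj₂)
open import Data.Vec as Vec using (Vec; []; _∷_; lookup; tabulate; replicate)
open import Function using (id; _∘_; _⇔_; mk⇔; Equivalence)
open Equivalence using (to; from)
open import Function.Construct.Symmetry using (⇔-sym)
open import Level using (0ℓ)
open import Relation.Binary.PropositionalEquality
open import Relation.Nullary using (Dec; yes; no; does; ¬_; ¬?)
open import Relation.Nullary.Decidable as Dec
  using (⌊_⌋; toWitness; fromWitness; map′; _×-dec_; _⊎-dec_; dec-true; dec-false)
open import Relation.Unary using (Pred; Decidable)

module ListSums where
  open import Data.List.Membership.Propositional using (_∈_)
  open import Data.List.Membership.Propositional.Properties using (∈-map⁺)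
  open import Data.List.Membership.Propositional.Properties.WithK using (unique∧set⇒bag)
  open import Data.List.Relation.Binary.BagAndSetEquality using (∼bag⇒↭)
  open import Data.List.Relation.Binary.Permutation.Propositional using (_↭_; ↭⇒↭ₛ)
  import Data.List.Relation.Binary.Permutation.Propositional.Properties as ↭
  open import Data.List.Relation.Binary.Permutation.Setoid.Properties ℤ.≡-setoid using (foldr-commMonoid)
  open import Data.List.Relation.Unary.Any using (here; there)

  private
    variable
      X Y : Set

  ∑ : List X → (X → ℤ) → ℤ
  ∑ xs f = sumℤ (map f xs)

  syntax ∑ xs (λ x → e) = ∑[ x ← xs ] e

  𝟙 : {P : Set} → Dec P → ℤ
  𝟙 p = if does p then 1ℤ else 0ℤ

  𝟙-yes : {P : Set} (p : Dec P) → P → 𝟙 p ≡ 1ℤ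
  𝟙-yes (yes _) _ = refl
  𝟙-yes (no ¬p) p = ⊥-elim (¬p p)

  𝟙-no : {P : Set} (p : Dec P) → ¬ P → 𝟙 p ≡ 0ℤ
  𝟙-no (yes p) ¬p = ⊥-elim (¬p p)
  𝟙-no (no _) _ = refl

  𝟙-cong : {P Q : Set} (p : Dec P) (q : Dec Q) → P ⇔ Q → 𝟙 p ≡ 𝟙 q
  𝟙-cong p (yes q) P⇔Q = 𝟙-yes p (from P⇔Q q)
  𝟙-cong p (no ¬q) P⇔Q = 𝟙-no p (¬q ∘ to P⇔Q)

  𝟙-× : {P Q : Set} (p : Dec P) (q : Dec Q) → 𝟙 (p ×-dec q) ≡ 𝟙 p * 𝟙 q
  𝟙-× (yes _) (yes _) = refl
  𝟙-× (yes _) (no _)  = refl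
  𝟙-× (no _)  q       = sym (ℤ.*-zeroˡ (𝟙 q))

  ∑-++ : (xs ys : List X) (f : X → ℤ) → ∑ (xs ++ ys) f ≡ ∑ xs f + ∑ ys f
  ∑-++ []       ys f = sym (ℤ.+-identityˡ _)
  ∑-++ (x ∷ xs) ys f = trans (cong (_+_ (f x)) (∑-++ xs ys f)) (sym (ℤ.+-assoc (f x) _ _))

  ∑-cong : (xs : List X) {f g : X → ℤ} → (∀ x → f x ≡ g x) → ∑ xs f ≡ ∑ xs g
  ∑-cong []       f≗g = refl
  ∑-cong (x ∷ xs) f≗g = cong₂ _+_ (f≗g x) (∑-cong xs f≗g)

  ∑-cong-∈ : (xs : List X) {f g : X → ℤ} → (∀ x → x ∈ xs → f x ≡ g x) → ∑ xs f ≡ ∑ xs g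
  ∑-cong-∈ []       f≗g = refl
  ∑-cong-∈ (x ∷ xs) f≗g = cong₂ _+_ (f≗g x (here refl)) (∑-cong-∈ xs (λ y → f≗g y ∘ there))

  ∑-+ : (xs : List X) (f g : X → ℤ) → ∑[ x ← xs ] (f x + g x) ≡ ∑ xs f + ∑ xs g
  ∑-+ []       f g = refl
  ∑-+ (x ∷ xs) f g = trans (cong (_+_ (f x + g x)) (∑-+ xs f g)) (+-interchange (f x) (g x) _ _)

  ∑-*ˡ : (xs : List X) (c : ℤ) (f : X → ℤ) → ∑[ x ← xs ] (c * f x) ≡ c * ∑ xs f
  ∑-*ˡ []       c f = sym (ℤ.*-zeroʳ c)
  ∑-*ˡ (x ∷ xs) c f = trans (cong (_+_ (c * f x)) (∑-*ˡ xs c f)) (sym (ℤ.*-distribˡ-+ c (f x) _))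

  ∑-0 : (xs : List X) → ∑[ x ← xs ] 0ℤ ≡ 0ℤ
  ∑-0 []       = refl
  ∑-0 (x ∷ xs) = trans (ℤ.+-identityˡ _) (∑-0 xs)

  ∑-const : (xs : List X) (c : ℤ) → ∑[ x ← xs ] c ≡ + length xs * c
  ∑-const []       c = sym (ℤ.*-zeroˡ c)
  ∑-const (x ∷ xs) c = begin
    c + ∑[ x ← xs ] c           ≡⟨ cong (_+_ c) (∑-const xs c) ⟩
    c + + length xs * c         ≡⟨ cong (_+ + length xs * c) (sym (ℤ.*-identityˡ c)) ⟩
    1ℤ * c + + length xs * c    ≡⟨ sym (ℤ.*-distribʳ-+ c 1ℤ (+ length xs)) ⟩
    + length (x ∷ xs) * c       ∎
    where open ≡-Reasoning

  ∑-map : (g : X → Y) (xs : List X) (f : Y → ℤ) → ∑ (map g xs) f ≡ ∑[ x ← xs ] f (g x)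
  ∑-map g []       f = refl
  ∑-map g (x ∷ xs) f = cong (_+_ (f (g x))) (∑-map g xs f)

  ∑-concatMap : (g : X → List Y) (xs : List X) (f : Y → ℤ) →
                ∑ (concatMap g xs) f ≡ ∑[ x ← xs ] ∑ (g x) f
  ∑-concatMap g []       f = refl
  ∑-concatMap g (x ∷ xs) f =
    trans (∑-++ (g x) (concatMap g xs) f) (cong (_+_ (∑ (g x) f)) (∑-concatMap g xs f))

  ∑-comm : (xs : List X) (ys : List Y) (f : X → Y → ℤ) →
           ∑[ x ← xs ] ∑[ y ← ys ] f x y ≡ ∑[ y ← ys ] ∑[ x ← xs ] f x y
  ∑-comm []       ys f = sym (∑-0 ys)
  ∑-comm (x ∷ xs) ys f =
    trans (cong (_+_ (∑ ys (f x))) (∑-comm xs ys f)) (sym (∑-+ ys (f x) _))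

  ∑-↭ : {xs ys : List X} (f : X → ℤ) → xs ↭ ys → ∑ xs f ≡ ∑ ys f
  ∑-↭ f xs↭ys = foldr-commMonoid ℤ.+-0-isCommutativeMonoid (↭⇒↭ₛ (↭.map⁺ f xs↭ys))

  ∑-same-elements : {xs ys : List X} → Unique xs → Unique ys → (∀ {x} → x ∈ xs ⇔ x ∈ ys) →
                    (f : X → ℤ) → ∑ xs f ≡ ∑ ys f
  ∑-same-elements unique-xs unique-ys same f = ∑-↭ f (∼bag⇒↭ (unique∧set⇒bag unique-xs unique-ys same))

  ∑-reindex : {xs : List X} → Unique xs → (∀ x → x ∈ xs) →
              (g h : X → X) → (∀ x → g (h x) ≡ x) → (∀ x → h (g x) ≡ x) →
              (f : X → ℤ) → ∑[ x ← xs ] f (g x) ≡ ∑ xs f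
  ∑-reindex {xs = xs} unique complete g h gh hg f =
    trans (sym (∑-map g xs f)) (∑-same-elements (Unique.map⁺ g-injective unique) unique same-elements f)
    where
    same-elements : ∀ {x} → x ∈ map g xs ⇔ x ∈ xs
    same-elements {x} = mk⇔ (λ _ → complete x) (λ _ → subst (_∈ map g xs) (gh x) (∈-map⁺ g (complete (h x))))
    g-injective : ∀ {x y} → g x ≡ g y → x ≡ y
    g-injective {x} {y} gx≡gy = trans (sym (hg x)) (trans (cong h gx≡gy) (hg y))

  ∑-filter : {P : Pred X 0ℓ} (P? : Decidable P) (xs : List X) (f : X → ℤ) →
             ∑ (filter P? xs) f ≡ ∑[ x ← xs ] (𝟙 (P? x) * f x)
  ∑-filter P? []       f = refl
  ∑-filter P? (x ∷ xs) f with does (P? x)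
  ... | true  = cong₂ _+_ (sym (ℤ.*-identityˡ (f x))) (∑-filter P? xs f)
  ... | false = begin
    ∑ (filter P? xs) f   ≡⟨ ∑-filter P? xs f ⟩
    rest                 ≡⟨ ℤ.+-identityˡ rest ⟨
    0ℤ + rest            ≡⟨ cong (_+ rest) (ℤ.*-zeroˡ (f x)) ⟨
    0ℤ * f x + rest      ∎
    where
    open ≡-Reasoning
    rest = ∑[ y ← xs ] (𝟙 (P? y) * f y)

  length-filter : {P : Pred X 0ℓ} (P? : Decidable P) (xs : List X) →
                  + length (filter P? xs) ≡ ∑[ x ← xs ] 𝟙 (P? x)
  length-filter P? []       = refl
  length-filter P? (x ∷ xs) with does (P? x)
  ... | true  = cong (_+_ 1ℤ) (length-filter P? xs)
  ... | false = trans (length-filter P? xs) (sym (ℤ.+-identityˡ _))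

  ∑-sign-reversing-involution :
    {xs : List X} → Unique xs → (∀ x → x ∈ xs) →
    (ι : X → X) → Involutive _≡_ ι →
    {P : Pred X 0ℓ} (P? : Decidable P) → (∀ x → P x → ι x ≡ x) →
    (f : X → ℤ) → (∀ x → ¬ P x → f (ι x) ≡ - f x) →
    ∑ xs f ≡ ∑ (filter P? xs) f
  ∑-sign-reversing-involution {xs = xs} unique complete ι ιι P? fixed f reverses =
    ℤ.*-cancelˡ-≡ (+ 2) _ _ (begin
      + 2 * ∑ xs f                          ≡⟨ double (∑ xs f) ⟩
      ∑ xs f + ∑ xs f                       ≡⟨ cong (_+ ∑ xs f) (∑-reindex unique complete ι ι ιι ιι f) ⟨
      ∑[ x ← xs ] f (ι x) + ∑ xs f          ≡⟨ sym (∑-+ xs (f ∘ ι) f) ⟩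
      ∑[ x ← xs ] (f (ι x) + f x)           ≡⟨ ∑-cong xs pair ⟩
      ∑[ x ← xs ] (+ 2 * (𝟙 (P? x) * f x))  ≡⟨ ∑-*ˡ xs (+ 2) _ ⟩
      + 2 * ∑[ x ← xs ] (𝟙 (P? x) * f x)    ≡⟨ cong (+ 2 *_) (sym (∑-filter P? xs f)) ⟩
      + 2 * ∑ (filter P? xs) f              ∎)
    where
    open ≡-Reasoning
    double : ∀ a → + 2 * a ≡ a + a
    double = solve-∀
    pair : ∀ x → f (ι x) + f x ≡ + 2 * (𝟙 (P? x) * f x)
    pair x with P? x
    ... | yes p = begin
      f (ι x) + f x         ≡⟨ cong (λ y → f y + f x) (fixed x p) ⟩
      f x + f x             ≡⟨ double (f x) ⟨
      + 2 * f x             ≡⟨ cong (+ 2 *_) (ℤ.*-identityˡ (f x)) ⟨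
      + 2 * (1ℤ * f x)      ∎
    ... | no ¬p = begin
      f (ι x) + f x         ≡⟨ cong (_+ f x) (reverses x ¬p) ⟩
      - f x + f x           ≡⟨ ℤ.+-inverseˡ (f x) ⟩
      0ℤ                    ≡⟨ ℤ.*-zeroʳ (+ 2) ⟨
      + 2 * 0ℤ              ≡⟨ cong (+ 2 *_) (ℤ.*-zeroˡ (f x)) ⟨
      + 2 * (0ℤ * f x)      ∎

open ListSums

module SumsOverSubsets where
  open import Data.List.Membership.Propositional using (_∈_)
  open import Data.List.Membership.Propositional.Properties using (∈-map⁺; ∈-map⁻; ∈-++⁺ˡ; ∈-++⁺ʳ)
  open import Data.List.Relation.Unary.Any using (here)
  open import Data.List.Relation.Unary.AllPairs using ([]; _∷_)
  open import Data.List.Relation.Unary.All using ([])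
  open import Data.Vec.Properties using (∷-injectiveʳ)

  subsets : ∀ m → List (Subset m)
  subsets zero    = [] ∷ []
  subsets (suc m) = map (false ∷_) (subsets m) ++ map (true ∷_) (subsets m)

  ∈-subsets : ∀ {m} (A : Subset m) → A ∈ subsets m
  ∈-subsets []          = here refl
  ∈-subsets (false ∷ A) = ∈-++⁺ˡ (∈-map⁺ (false ∷_) (∈-subsets A))
  ∈-subsets (true ∷ A)  = ∈-++⁺ʳ _ (∈-map⁺ (true ∷_) (∈-subsets A))

  subsets-unique : ∀ m → Unique (subsets m)
  subsets-unique zero    = [] ∷ []
  subsets-unique (suc m) =
    Unique.++⁺ (Unique.map⁺ ∷-injectiveʳ (subsets-unique m)) (Unique.map⁺ ∷-injectiveʳ (subsets-unique m)) disjoint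
    where
    disjoint : ∀ {A} → ¬ (A ∈ map (false ∷_) (subsets m) × A ∈ map (true ∷_) (subsets m))
    disjoint (A∈₀ , A∈₁) with ∈-map⁻ (false ∷_) A∈₀ | ∈-map⁻ (true ∷_) A∈₁
    ... | _ , _ , refl | _ , _ , ()

  ∑-subsets-suc : ∀ {m} (f : Subset (suc m) → ℤ) →
    ∑ (subsets (suc m)) f ≡ ∑[ A ← subsets m ] f (false ∷ A) + ∑[ A ← subsets m ] f (true ∷ A)
  ∑-subsets-suc {m} f = begin
    ∑ (subsets (suc m)) f                                        ≡⟨ ∑-++ (map (false ∷_) (subsets m)) _ f ⟩
    ∑ (map (false ∷_) (subsets m)) f + ∑ (map (true ∷_) (subsets m)) f
      ≡⟨ cong₂ _+_ (∑-map (false ∷_) (subsets m) f) (∑-map (true ∷_) (subsets m) f) ⟩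
    ∑[ A ← subsets m ] f (false ∷ A) + ∑[ A ← subsets m ] f (true ∷ A) ∎
    where open ≡-Reasoning

  -- ⊆? computes on cons cells, so 𝟙 ((true ∷ A) ⊆? (false ∷ S)) reduces to 0ℤ below.
  ∑-subsets-alternating : ∀ {m} (S : Subset m) →
                          ∑[ A ← subsets m ] (-1ℤ ^ℤ ∣ A ∣ * 𝟙 (A ⊆? S)) ≡ 𝟙 (S ⊆? ⊥)
  ∑-subsets-alternating []                  = refl
  ∑-subsets-alternating {suc m} (false ∷ S) = begin
    ∑[ A ← subsets (suc m) ] (-1ℤ ^ℤ ∣ A ∣ * 𝟙 (A ⊆? (false ∷ S)))
      ≡⟨ ∑-subsets-suc (λ A → -1ℤ ^ℤ ∣ A ∣ * 𝟙 (A ⊆? (false ∷ S))) ⟩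
    x + ∑[ A ← subsets m ] (-1ℤ ^ℤ suc ∣ A ∣ * 0ℤ)
      ≡⟨ cong (_+_ x) (∑-cong (subsets m) (λ A → ℤ.*-zeroʳ (-1ℤ ^ℤ suc ∣ A ∣))) ⟩
    x + ∑[ A ← subsets m ] 0ℤ    ≡⟨ cong₂ _+_ (∑-subsets-alternating S) (∑-0 (subsets m)) ⟩
    𝟙 (S ⊆? ⊥) + 0ℤ              ≡⟨ ℤ.+-identityʳ _ ⟩
    𝟙 (S ⊆? ⊥)                   ∎
    where
    open ≡-Reasoning
    x = ∑[ A ← subsets m ] (-1ℤ ^ℤ ∣ A ∣ * 𝟙 (A ⊆? S))
  ∑-subsets-alternating {suc m} (true ∷ S) = begin
    ∑[ A ← subsets (suc m) ] (-1ℤ ^ℤ ∣ A ∣ * 𝟙 (A ⊆? (true ∷ S)))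
      ≡⟨ ∑-subsets-suc (λ A → -1ℤ ^ℤ ∣ A ∣ * 𝟙 (A ⊆? (true ∷ S))) ⟩
    x + ∑[ A ← subsets m ] ((-1ℤ * -1ℤ ^ℤ ∣ A ∣) * 𝟙 (A ⊆? S))
      ≡⟨ cong (_+_ x) (∑-cong (subsets m) (λ A → ℤ.*-assoc -1ℤ (-1ℤ ^ℤ ∣ A ∣) (𝟙 (A ⊆? S)))) ⟩
    x + ∑[ A ← subsets m ] (-1ℤ * (-1ℤ ^ℤ ∣ A ∣ * 𝟙 (A ⊆? S)))
      ≡⟨ cong (_+_ x) (∑-*ˡ (subsets m) -1ℤ _) ⟩
    x + -1ℤ * x                  ≡⟨ a-a≡0 x ⟩
    0ℤ                           ∎
    where
    open ≡-Reasoning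
    x = ∑[ A ← subsets m ] (-1ℤ ^ℤ ∣ A ∣ * 𝟙 (A ⊆? S))
    a-a≡0 : ∀ a → a + -1ℤ * a ≡ 0ℤ
    a-a≡0 = solve-∀

open SumsOverSubsets

module SumsOverColourings where
  open import Data.List.Membership.Propositional using (_∈_)
  open import Data.List.Membership.Propositional.Properties
    using (∈-map⁺; ∈-allFin; ∈-concatMap⁺; ∈-filter⁺; ∈-length)
  import Data.List.Relation.Unary.Any as Any
  open import Data.List.Relation.Unary.Any using (here)

  ∑-allFin-suc : ∀ {q} (f : Fin (suc q) → ℤ) → ∑ (allFin (suc q)) f ≡ f zero + ∑[ a ← allFin q ] f (suc a)
  ∑-allFin-suc {q} f =
    cong (_+_ (f zero) ∘ sumℤ) (trans (List.map-tabulate suc f) (sym (List.map-tabulate id (f ∘ suc))))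

  ∑-allFin-𝟙 : ∀ {q} (c : Fin q) (g : Fin q → ℤ) → ∑[ a ← allFin q ] (𝟙 (c ≟ a) * g a) ≡ g c
  ∑-allFin-𝟙 {suc q} zero g = begin
    ∑[ a ← allFin (suc q) ] (𝟙 (zero ≟ a) * g a)   ≡⟨ ∑-allFin-suc (λ a → 𝟙 (zero ≟ a) * g a) ⟩
    1ℤ * g zero + ∑[ a ← allFin q ] (0ℤ * g (suc a))
      ≡⟨ cong₂ _+_ (ℤ.*-identityˡ (g zero))
                   (trans (∑-cong (allFin q) (ℤ.*-zeroˡ ∘ g ∘ suc)) (∑-0 (allFin q))) ⟩
    g zero + 0ℤ                                      ≡⟨ ℤ.+-identityʳ (g zero) ⟩
    g zero                                           ∎
    where open ≡-Reasoning
  ∑-allFin-𝟙 {suc q} (suc c) g = begin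
    ∑[ a ← allFin (suc q) ] (𝟙 (suc c ≟ a) * g a)  ≡⟨ ∑-allFin-suc (λ a → 𝟙 (suc c ≟ a) * g a) ⟩
    0ℤ * g zero + ∑[ a ← allFin q ] (𝟙 (c ≟ a) * g (suc a))
      ≡⟨ cong₂ _+_ (ℤ.*-zeroˡ (g zero)) (∑-allFin-𝟙 c (g ∘ suc)) ⟩
    0ℤ + g (suc c)                                   ≡⟨ ℤ.+-identityˡ (g (suc c)) ⟩
    g (suc c)                                        ∎
    where open ≡-Reasoning

  ∑-allFin-permute : ∀ {q} (π : Permutation′ q) (f : Fin q → ℤ) →
                     ∑[ c ← allFin q ] f (π ⟨$⟩ʳ c) ≡ ∑ (allFin q) f
  ∑-allFin-permute {q} π =
    ∑-reindex (Unique.allFin⁺ q) ∈-allFin (π ⟨$⟩ʳ_) (π ⟨$⟩ˡ_) (λ _ → inverseʳ π) (λ _ → inverseˡ π)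

  ∑-allVecs-suc : ∀ {q n} (f : Vec (Fin q) (suc n) → ℤ) →
                  ∑ (allVecs q (suc n)) f ≡ ∑[ c ← allFin q ] ∑[ κ ← allVecs q n ] f (c ∷ κ)
  ∑-allVecs-suc {q} {n} f = trans (∑-concatMap (λ c → map (c ∷_) (allVecs q n)) (allFin q) f)
                                  (∑-cong (allFin q) (λ c → ∑-map (c ∷_) (allVecs q n) f))

  ∑-allVecs-1 : ∀ q n → ∑[ κ ← allVecs q n ] 1ℤ ≡ + (q ^ n)
  ∑-allVecs-1 q zero    = refl
  ∑-allVecs-1 q (suc n) = begin
    ∑[ κ ← allVecs q (suc n) ] 1ℤ               ≡⟨ ∑-allVecs-suc {q} {n} (λ _ → 1ℤ) ⟩
    ∑[ c ← allFin q ] ∑[ κ ← allVecs q n ] 1ℤ   ≡⟨ ∑-cong (allFin q) (λ _ → ∑-allVecs-1 q n) ⟩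
    ∑[ c ← allFin q ] (+ (q ^ n))                ≡⟨ ∑-const (allFin q) (+ (q ^ n)) ⟩
    + length (allFin q) * + (q ^ n)             ≡⟨ cong (λ l → + l * + (q ^ n)) (List.length-tabulate {n = q} id) ⟩
    + q * + (q ^ n)                             ≡⟨ ℤ.pos-* q (q ^ n) ⟨
    + (q ^ suc n)                               ∎
    where open ≡-Reasoning

  ∈-allVecs : ∀ {q n} (κ : Vec (Fin q) n) → κ ∈ allVecs q n
  ∈-allVecs []      = here refl
  ∈-allVecs (c ∷ κ) = ∈-concatMap⁺ _ (Any.map (λ { refl → ∈-map⁺ (c ∷_) (∈-allVecs κ) }) (∈-allFin c))

  recolour : ∀ {q n} → (Fin n → Permutation′ q) → Vec (Fin q) n → Vec (Fin q) n
  recolour π κ = tabulate (λ i → π i ⟨$⟩ʳ lookup κ i)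

  ∑-allVecs-recolour : ∀ {q n} (π : Fin n → Permutation′ q) (f : Vec (Fin q) n → ℤ) →
                       ∑[ κ ← allVecs q n ] f (recolour π κ) ≡ ∑ (allVecs q n) f
  ∑-allVecs-recolour {n = zero}      π f = refl
  ∑-allVecs-recolour {q} {suc n} π f = begin
    ∑[ κ ← allVecs q (suc n) ] f (recolour π κ)                      ≡⟨ ∑-allVecs-suc (f ∘ recolour π) ⟩
    ∑[ c ← allFin q ] ∑[ κ ← allVecs q n ] f ((π zero ⟨$⟩ʳ c) ∷ recolour (π ∘ suc) κ)
      ≡⟨ ∑-cong (allFin q) (λ c → ∑-allVecs-recolour (π ∘ suc) (λ κ → f ((π zero ⟨$⟩ʳ c) ∷ κ))) ⟩
    ∑[ c ← allFin q ] ∑[ κ ← allVecs q n ] f ((π zero ⟨$⟩ʳ c) ∷ κ)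
      ≡⟨ ∑-allFin-permute (π zero) (λ c → ∑[ κ ← allVecs q n ] f (c ∷ κ)) ⟩
    ∑[ c ← allFin q ] ∑[ κ ← allVecs q n ] f (c ∷ κ)                 ≡⟨ ∑-allVecs-suc f ⟨
    ∑ (allVecs q (suc n)) f                                          ∎
    where open ≡-Reasoning

  transpose-maps : ∀ {q} (a b : Fin q) → transpose a b ⟨$⟩ʳ a ≡ b
  transpose-maps a b rewrite dec-true (a ≟ a) refl = refl

  ⟨$⟩ʳ-injective : ∀ {q} (π : Permutation′ q) {x y : Fin q} → π ⟨$⟩ʳ x ≡ π ⟨$⟩ʳ y → x ≡ y
  ⟨$⟩ʳ-injective π πx≡πy = trans (sym (inverseˡ π)) (trans (cong (π ⟨$⟩ˡ_) πx≡πy) (inverseˡ π))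

  𝟙-permute : ∀ {q} (π : Permutation′ q) {a b c : Fin q} → π ⟨$⟩ʳ a ≡ b → 𝟙 (π ⟨$⟩ʳ c ≟ b) ≡ 𝟙 (c ≟ a)
  𝟙-permute π πa≡b =
    𝟙-cong (_ ≟ _) (_ ≟ _) (mk⇔ (λ πc≡b → ⟨$⟩ʳ-injective π (trans πc≡b (sym πa≡b))) (λ { refl → πa≡b }))

  allVecs-0 : ∀ {n} → 0 ℕ.< n → allVecs 0 n ≡ []
  allVecs-0 {suc n} _ = refl

  two-constant-colourings : ∀ {n} → 0 ℕ.< n → {P : Pred (Vec (Fin 2) n) 0ℓ} (P? : Decidable P) →
                            (∀ c → P (replicate n c)) → 2 ℕ.≤ length (filter P? (allVecs 2 n))
  two-constant-colourings {suc n} _ P? constant = begin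
    1 ℕ.+ 1                                    ≤⟨ ℕ.+-mono-≤ (contains zero) (contains (suc zero)) ⟩
    length (filter P? (colour zero)) ℕ.+ length (filter P? (colour (suc zero)))
      ≡⟨ List.length-++ (filter P? (colour zero)) ⟨
    length (filter P? (colour zero) ++ filter P? (colour (suc zero)))
      ≡⟨ cong length (List.filter-++ P? (colour zero) (colour (suc zero))) ⟨
    length (filter P? (colour zero ++ colour (suc zero)))
      ≡⟨ cong (λ vs → length (filter P? (colour zero ++ vs))) (List.++-identityʳ (colour (suc zero))) ⟨
    length (filter P? (allVecs 2 (suc n)))     ∎
    where
    open ℕ.≤-Reasoning
    colour : Fin 2 → List (Vec (Fin 2) (suc n))
    colour c = map (c ∷_) (allVecs 2 n)
    contains : ∀ c → 1 ℕ.≤ length (filter P? (colour c))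
    contains c = ∈-length (∈-filter⁺ P? (∈-map⁺ (c ∷_) (∈-allVecs (replicate n c))) (constant c))

open SumsOverColourings

module SubsetProperties where
  open import Data.Fin.Subset using (_∈_; _∉_)
  open import Data.Vec using (here; there)
  open import Data.Vec.Properties using (lookup∘tabulate; []=⇒lookup; lookup⇒[]=)

  private
    variable
      k : ℕ

  ∈⇔T-lookup : {p : Subset k} {x : Fin k} → x ∈ p ⇔ T (lookup p x)
  ∈⇔T-lookup {p = p} {x} = mk⇔ (from T-≡ ∘ []=⇒lookup) (lookup⇒[]= x p ∘ to T-≡)

  ∈-tabulate : (f : Fin k → Bool) {x : Fin k} → x ∈ tabulate f ⇔ T (f x)
  ∈-tabulate f {x} = mk⇔ (subst T (lookup∘tabulate f x) ∘ to ∈⇔T-lookup)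
                         (from ∈⇔T-lookup ∘ subst T (sym (lookup∘tabulate f x)))

  ∈-tabulate-does : {P : Pred (Fin k) 0ℓ} (P? : Decidable P) {x : Fin k} →
                    x ∈ tabulate (λ y → does (P? y)) ⇔ P x
  ∈-tabulate-does {P = P} P? {x} = mk⇔ holds (from (∈-tabulate _) ∘ T-does (P? x))
    where
    T-does : ∀ {P} (P? : Dec P) → P → T (does P?)
    T-does (yes _) _ = _
    T-does (no ¬p) p = ¬p p
    holds : x ∈ tabulate (λ y → does (P? y)) → P x
    holds x∈ with P? x | to (∈-tabulate (λ y → does (P? y))) x∈
    ... | yes p | _  = p
    ... | no _  | ()

  x∉p-x : (p : Subset k) (x : Fin k) → x ∉ p - x
  x∉p-x (b ∷ p) zero    ()
  x∉p-x (b ∷ p) (suc x) (there x∈p-x) = x∉p-x p x x∈p-x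

  x∈p-y⇒x∈p∧x≢y : {p : Subset k} {x y : Fin k} → y ∈ p - x → y ∈ p × y ≢ x
  x∈p-y⇒x∈p∧x≢y {p = p} {x} y∈p-x = p─q⊆p p ⁅ x ⁆ y∈p-x , λ { refl → x∉p-x p x y∈p-x }

  suc∣p-x∣≡∣p∣ : {p : Subset k} {x : Fin k} → x ∈ p → suc ∣ p - x ∣ ≡ ∣ p ∣
  suc∣p-x∣≡∣p∣ {p = true ∷ p}  here          = cong suc (cong ∣_∣ (p─⊥≡p p))
  suc∣p-x∣≡∣p∣ {p = true ∷ p}  (there x∈p)   = cong suc (suc∣p-x∣≡∣p∣ x∈p)
  suc∣p-x∣≡∣p∣ {p = false ∷ p} (there x∈p)   = suc∣p-x∣≡∣p∣ x∈p

  2≤∣p∣ : {p : Subset k} {x y : Fin k} → x ∈ p → y ∈ p → x ≢ y → 2 ≤ ∣ p ∣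
  2≤∣p∣ {p = p} {x} {y} x∈p y∈p x≢y = ℕ.≤-<-trans 1≤∣p-x∣ (x∈p⇒∣p-x∣<∣p∣ x∈p)
    where
    ⁅y⁆⊆p-x : ⁅ y ⁆ ⊆ p - x
    ⁅y⁆⊆p-x z∈⁅y⁆ with refl ← x∈⁅y⁆⇒x≡y y z∈⁅y⁆ = x∈p∧x≢y⇒x∈p-y y∈p (x≢y ∘ sym)
    1≤∣p-x∣ : 1 ≤ ∣ p - x ∣
    1≤∣p-x∣ = subst (_≤ ∣ p - x ∣) (∣⁅x⁆∣≡1 y) (p⊆q⇒∣p∣≤∣q∣ ⁅y⁆⊆p-x)

  toggle : Subset k → Fin k → Subset k
  toggle (b ∷ p) zero    = not b ∷ p
  toggle (b ∷ p) (suc x) = b ∷ toggle p x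

  toggle-involutive : (p : Subset k) (x : Fin k) → toggle (toggle p x) x ≡ p
  toggle-involutive (true ∷ p)  zero    = refl
  toggle-involutive (false ∷ p) zero    = refl
  toggle-involutive (b ∷ p)     (suc x) = cong (b ∷_) (toggle-involutive p x)

  ∈-toggle-≢ : (p : Subset k) {x y : Fin k} → y ≢ x → y ∈ toggle p x ⇔ y ∈ p
  ∈-toggle-≢ p {x} {y} y≢x = mk⇔ (forth p x y≢x) (back p x y≢x)
    where
    forth : ∀ {k} (p : Subset k) x {y} → y ≢ x → y ∈ toggle p x → y ∈ p
    forth (b ∷ p) zero    {zero}  y≢x _            = ⊥-elim (y≢x refl)
    forth (b ∷ p) zero    {suc y} y≢x (there y∈)   = there y∈
    forth (b ∷ p) (suc x) {zero}  y≢x here         = here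
    forth (b ∷ p) (suc x) {suc y} y≢x (there y∈)   = there (forth p x (y≢x ∘ cong suc) y∈)
    back : ∀ {k} (p : Subset k) x {y} → y ≢ x → y ∈ p → y ∈ toggle p x
    back (b ∷ p) zero    {zero}  y≢x _          = ⊥-elim (y≢x refl)
    back (b ∷ p) zero    {suc y} y≢x (there y∈) = there y∈
    back (b ∷ p) (suc x) {zero}  y≢x here       = here
    back (b ∷ p) (suc x) {suc y} y≢x (there y∈) = there (back p x (y≢x ∘ cong suc) y∈)

  sign-toggle : (p : Subset k) (x : Fin k) → -1ℤ ^ℤ ∣ toggle p x ∣ ≡ - (-1ℤ ^ℤ ∣ p ∣)
  sign-toggle (true ∷ p)  zero    = sym (trans (cong -_ (ℤ.-1*i≡-i _)) (ℤ.neg-involutive _))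
  sign-toggle (false ∷ p) zero    = ℤ.-1*i≡-i _
  sign-toggle (true ∷ p)  (suc x) = trans (cong (-1ℤ *_) (sign-toggle p x)) (-1*-a≡-[-1*a] _)
    where
    -1*-a≡-[-1*a] : ∀ a → -1ℤ * - a ≡ - (-1ℤ * a)
    -1*-a≡-[-1*a] = solve-∀
  sign-toggle (false ∷ p) (suc x) = sign-toggle p x

open SubsetProperties

module Connectivity {n : ℕ} (G : Graph n) where
  open import Data.Fin.Subset using (_∈_)
  import Data.List.Membership.Propositional as List using (_∈_; lose)
  open import Data.List.Membership.Propositional.Properties using (∈-allFin)
  import Data.List.Relation.Unary.Any as Any
  open import Data.List.Relation.Unary.Any.Properties using (any⁺; any⁻)

  open Graph G

  src≢tgt : ∀ k → src k ≢ tgt k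
  src≢tgt k = Fin.<⇒≢ (ordered k)

  joins-sym : ∀ {k x y} → Joins G k x y → Joins G k y x
  joins-sym fwd = bwd
  joins-sym bwd = fwd

  reach-edge : ∀ {H k} → k ∈ H → Reach G H (src k) (tgt k)
  reach-edge k∈H = step _ k∈H fwd here

  reach-trans : ∀ {H x y z} → Reach G H x y → Reach G H y z → Reach G H x z
  reach-trans here               y⇝z = y⇝z
  reach-trans (step k k∈H j x⇝y) y⇝z = step k k∈H j (reach-trans x⇝y y⇝z)

  reach-sym : ∀ {H x y} → Reach G H x y → Reach G H y x
  reach-sym here               = here
  reach-sym (step k k∈H j x⇝y) = reach-trans (reach-sym x⇝y) (step k k∈H (joins-sym j) here)

  reach-map : ∀ {H₁ H₂ x y} → (∀ {k} → k ∈ H₁ → Reach G H₂ (src k) (tgt k)) → Reach G H₁ x y → Reach G H₂ x y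
  reach-map f here                 = here
  reach-map f (step k k∈H fwd x⇝y) = reach-trans (f k∈H) (reach-map f x⇝y)
  reach-map f (step k k∈H bwd x⇝y) = reach-trans (reach-sym (f k∈H)) (reach-map f x⇝y)

  reach-mono : ∀ {H₁ H₂ x y} → H₁ ⊆ H₂ → Reach G H₁ x y → Reach G H₂ x y
  reach-mono H₁⊆H₂ = reach-map (reach-edge ∘ H₁⊆H₂)

  reach-del : ∀ {H k x y} → Reach G (H - k) x y → Reach G H x y
  reach-del = reach-mono (proj₁ ∘ x∈p-y⇒x∈p∧x≢y)

  reach-split : ∀ {H k x y} → k ∈ H → Reach G H x y →
                Reach G (H - k) x y
                ⊎ (Reach G (H - k) x (src k) × Reach G (H - k) (tgt k) y)
                ⊎ (Reach G (H - k) x (tgt k) × Reach G (H - k) (src k) y)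
  reach-split k∈H here = inj₁ here
  reach-split {k = k} k∈H (step l l∈H j x⇝y) with l ≟ k | reach-split k∈H x⇝y
  ... | no l≢k | inj₁ p                = inj₁ (step l (x∈p∧x≢y⇒x∈p-y l∈H l≢k) j p)
  ... | no l≢k | inj₂ (inj₁ (p , q))   = inj₂ (inj₁ (step l (x∈p∧x≢y⇒x∈p-y l∈H l≢k) j p , q))
  ... | no l≢k | inj₂ (inj₂ (p , q))   = inj₂ (inj₂ (step l (x∈p∧x≢y⇒x∈p-y l∈H l≢k) j p , q))
  reach-split k∈H (step l l∈H fwd x⇝y) | yes refl | inj₁ p              = inj₂ (inj₁ (here , p))
  reach-split k∈H (step l l∈H fwd x⇝y) | yes refl | inj₂ (inj₁ (p , q)) = inj₂ (inj₁ (here , q))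
  reach-split k∈H (step l l∈H fwd x⇝y) | yes refl | inj₂ (inj₂ (p , q)) = inj₁ q
  reach-split k∈H (step l l∈H bwd x⇝y) | yes refl | inj₁ p              = inj₂ (inj₂ (here , p))
  reach-split k∈H (step l l∈H bwd x⇝y) | yes refl | inj₂ (inj₁ (p , q)) = inj₁ q
  reach-split k∈H (step l l∈H bwd x⇝y) | yes refl | inj₂ (inj₂ (p , q)) = inj₂ (inj₂ (here , q))

  reach-join : ∀ {H k x y} → k ∈ H →
               Reach G (H - k) x y
               ⊎ (Reach G (H - k) x (src k) × Reach G (H - k) (tgt k) y)
               ⊎ (Reach G (H - k) x (tgt k) × Reach G (H - k) (src k) y) →
               Reach G H x y
  reach-join k∈H (inj₁ p)              = reach-del p
  reach-join k∈H (inj₂ (inj₁ (p , q))) = reach-trans (reach-del p) (reach-trans (reach-edge k∈H) (reach-del q))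
  reach-join k∈H (inj₂ (inj₂ (p , q))) = reach-trans (reach-del p) (reach-trans (reach-sym (reach-edge k∈H)) (reach-del q))

  reach?-covered : (ks : List (Fin m)) (H : EdgeSet G) → (∀ {l} → l ∈ H → l List.∈ ks) →
                   ∀ x y → Dec (Reach G H x y)
  reach?-covered [] H covered x y = map′ (λ { refl → here }) only-here (x ≟ y)
    where
    only-here : ∀ {x y} → Reach G H x y → x ≡ y
    only-here here               = refl
    only-here (step l l∈H _ _) with () ← covered l∈H
  reach?-covered (k ∷ ks) H covered x y with k ∈? H
  ... | no k∉H = reach?-covered ks H covered′ x y
    where
    covered′ : ∀ {l} → l ∈ H → l List.∈ ks
    covered′ l∈H with covered l∈H
    ... | Any.here refl = ⊥-elim (k∉H l∈H)
    ... | Any.there l∈ks = l∈ks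
  ... | yes k∈H = map′ (reach-join k∈H) (reach-split k∈H)
                       (rec x y ⊎-dec (rec x (src k) ×-dec rec (tgt k) y)
                                ⊎-dec (rec x (tgt k) ×-dec rec (src k) y))
    where
    covered′ : ∀ {l} → l ∈ H - k → l List.∈ ks
    covered′ l∈H-k with x∈p-y⇒x∈p∧x≢y l∈H-k
    ... | l∈H , l≢k with covered l∈H
    ...   | Any.here l≡k  = ⊥-elim (l≢k l≡k)
    ...   | Any.there l∈ks = l∈ks
    rec = reach?-covered ks (H - k) covered′

  reach? : (H : EdgeSet G) → ∀ x y → Dec (Reach G H x y)
  reach? H = reach?-covered (allFin m) H (λ {l} _ → ∈-allFin l)

  component : EdgeSet G → Fin n → Subset n
  component A z = tabulate (λ y → does (reach? A z y))

  ∈-component⁺ : ∀ {A z y} → Reach G A z y → y ∈ component A z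
  ∈-component⁺ {A} {z} = from (∈-tabulate-does (reach? A z))

  ∈-component⁻ : ∀ {A z y} → y ∈ component A z → Reach G A z y
  ∈-component⁻ {A} {z} = to (∈-tabulate-does (reach? A z))

  component-≡ : ∀ {A z w} → Reach G A z w → component A w ≡ component A z
  component-≡ z⇝w = ⊆-antisym (λ y∈ → ∈-component⁺ (reach-trans z⇝w (∈-component⁻ y∈)))
                              (λ y∈ → ∈-component⁺ (reach-trans (reach-sym z⇝w) (∈-component⁻ y∈)))

  component-cong : ∀ {A B} → (∀ {x y} → Reach G A x y → Reach G B x y) →
                   (∀ {x y} → Reach G B x y → Reach G A x y) → ∀ z → component A z ≡ component B z
  component-cong A⇒B B⇒A z =
    ⊆-antisym (∈-component⁺ ∘ A⇒B ∘ ∈-component⁻) (∈-component⁺ ∘ B⇒A ∘ ∈-component⁻)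

  ∈-induced⁺ : ∀ {R l} → src l ∈ R → tgt l ∈ R → l ∈ induced G R
  ∈-induced⁺ s∈R t∈R = from (∈-tabulate _)
    (from T-∧ (to ∈⇔T-lookup s∈R , to ∈⇔T-lookup t∈R))

  ∈-induced⁻ : ∀ {R l} → l ∈ induced G R → src l ∈ R × tgt l ∈ R
  ∈-induced⁻ l∈ with to T-∧ (to (∈-tabulate _) l∈)
  ... | s , t = from ∈⇔T-lookup s , from ∈⇔T-lookup t

  joins-induced : ∀ {R k x y} → Joins G k x y → x ∈ R → y ∈ R → k ∈ induced G R
  joins-induced fwd x∈R y∈R = ∈-induced⁺ x∈R y∈R
  joins-induced bwd x∈R y∈R = ∈-induced⁺ y∈R x∈R

  componentEdges : EdgeSet G → Fin n → EdgeSet G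
  componentEdges A z = A ∩ induced G (component A z)

  reach-restrict : ∀ {H A z x y} → H ⊆ A → Reach G H x y → x ∈ component A z →
                   Reach G (H ∩ induced G (component A z)) x y
  reach-restrict H⊆A here x∈ = here
  reach-restrict H⊆A (step l l∈H j y⇝z) x∈ =
    step l (x∈p∩q⁺ (l∈H , joins-induced j x∈ y∈)) j (reach-restrict H⊆A y⇝z y∈)
    where
    y∈ = ∈-component⁺ (reach-trans (∈-component⁻ x∈) (step l (H⊆A l∈H) j here))

  component-connected : ∀ A z → ConnSpanning G (component A z) (componentEdges A z)
  component-connected A z = proj₂ ∘ x∈p∩q⁻ A _ , λ x y x∈ y∈ →
    reach-restrict id (reach-trans (reach-sym (∈-component⁻ x∈)) (∈-component⁻ y∈)) x∈

  component-InC : ∀ {A z e} → e ∈ induced G (component A z) → InC G (component A z)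
  component-InC {A} {z} {e} e∈R =
    (id , λ x y x∈ y∈ → reach-mono (proj₂ ∘ x∈p∩q⁻ A _) (proj₂ (component-connected A z) x y x∈ y∈))
    , 2≤∣p∣ (proj₁ ends) (proj₂ ends) (src≢tgt e)
    where ends = ∈-induced⁻ {component A z} e∈R

  reach-some-edge : ∀ {H x y} → Reach G H x y → x ≢ y → ∃[ k ] k ∈ H
  reach-some-edge here             x≢x = ⊥-elim (x≢x refl)
  reach-some-edge (step k k∈H _ _) _   = k , k∈H

  acyclic-mono : ∀ {H₁ H₂} → H₁ ⊆ H₂ → Acyclic G H₂ → Acyclic G H₁
  acyclic-mono H₁⊆H₂ acyclic k k∈H₁ cycle = acyclic k (H₁⊆H₂ k∈H₁) (reach-mono H₁-k⊆H₂-k cycle)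
    where
    H₁-k⊆H₂-k : ∀ {l} → l ∈ _ - k → l ∈ _ - k
    H₁-k⊆H₂-k l∈ = let l∈H₁ , l≢k = x∈p-y⇒x∈p∧x≢y l∈ in x∈p∧x≢y⇒x∈p-y (H₁⊆H₂ l∈H₁) l≢k

  spanning-tree-maximal : ∀ {R τ g} → SpanningTree G R τ → τ ⊆ g → g ⊆ induced G R → Acyclic G g → g ⊆ τ
  spanning-tree-maximal {τ = τ} ((_ , connected) , _) τ⊆g g⊆R acyclic {l} l∈g with l ∈? τ
  ... | yes l∈τ = l∈τ
  ... | no  l∉τ = ⊥-elim (acyclic l l∈g (reach-mono τ⊆g-l (connected (src l) (tgt l) s∈R t∈R)))
    where
    s∈R = proj₁ (∈-induced⁻ (g⊆R l∈g))
    t∈R = proj₂ (∈-induced⁻ (g⊆R l∈g))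
    τ⊆g-l : τ ⊆ _ - l
    τ⊆g-l k∈τ = x∈p∧x≢y⇒x∈p-y (τ⊆g k∈τ) (λ { refl → l∉τ k∈τ })

  Incident : EdgeSet G → Fin n → Set
  Incident τ x = ∃[ l ] (l ∈ τ × (src l ≡ x ⊎ tgt l ≡ x))

  ∈-vertexSet : ∀ {τ x} → x ∈ vertexSet G τ ⇔ Incident τ x
  ∈-vertexSet {τ} {x} = mk⇔ incident member
    where
    incident? : Fin m → Bool
    incident? k = lookup τ k ∧ (⌊ src k ≟ x ⌋ ∨ ⌊ tgt k ≟ x ⌋)
    incident : x ∈ vertexSet G τ → Incident τ x
    incident x∈ with Any.satisfied (any⁻ incident? (allFin m) (to (∈-tabulate _) x∈))
    ... | l , l-incident with to (T-∧ {lookup τ l}) l-incident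
    ...   | l∈τ , ends = l , from ∈⇔T-lookup l∈τ
                           , Sum.map (toWitness {a? = src l ≟ x}) (toWitness {a? = tgt l ≟ x})
                                          (to (T-∨ {⌊ src l ≟ x ⌋}) ends)
    member : Incident τ x → x ∈ vertexSet G τ
    member (l , l∈τ , ends) = from (∈-tabulate _) (any⁺ incident? (List.lose (∈-allFin l)
      (from (T-∧ {lookup τ l}) (to ∈⇔T-lookup l∈τ
        , from (T-∨ {⌊ src l ≟ x ⌋}) (Sum.map fromWitness fromWitness ends)))))

  componentEdges-Component : ∀ {A z k} → k ∈ componentEdges A z → Component G A (componentEdges A z)
  componentEdges-Component {A} {z} {k} k∈ = k , k∈ , λ l → members l , members⁻¹ l
    where
    z⇝k = ∈-component⁻ (proj₁ (∈-induced⁻ (proj₂ (x∈p∩q⁻ A _ k∈))))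
    members : ∀ l → l ∈ componentEdges A z → l ∈ A × Reach G A (src k) (src l)
    members l l∈ = let l∈A , l∈R = x∈p∩q⁻ A _ l∈ in
      l∈A , reach-trans (reach-sym z⇝k) (∈-component⁻ (proj₁ (∈-induced⁻ l∈R)))
    members⁻¹ : ∀ l → l ∈ A × Reach G A (src k) (src l) → l ∈ componentEdges A z
    members⁻¹ l (l∈A , k⇝l) = let z⇝l = reach-trans z⇝k k⇝l in
      x∈p∩q⁺ (l∈A , ∈-induced⁺ (∈-component⁺ z⇝l) (∈-component⁺ (reach-trans z⇝l (reach-edge l∈A))))

  Component-≡ : ∀ {A τ} (c : Component G A τ) → τ ≡ componentEdges A (src (proj₁ c))
  Component-≡ {A} (k , k∈τ , members) = ⊆-antisym (λ {l} l∈ → proj₂ (members′ l) (proj₁ (members l) l∈))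
                                                  (λ {l} l∈ → proj₂ (members l) (proj₁ (members′ l) l∈))
    where
    k∈A = proj₁ (proj₁ (members k) k∈τ)
    k∈ = x∈p∩q⁺ (k∈A , ∈-induced⁺ (∈-component⁺ here) (∈-component⁺ (reach-edge k∈A)))
    members′ = proj₂ (proj₂ (componentEdges-Component {k = k} k∈))

  incident-along : ∀ {A z x y} → Reach G A y x → y ∈ component A z →
                   Incident (componentEdges A z) y → Incident (componentEdges A z) x
  incident-along here               y∈ incident = incident
  incident-along {A} (step l l∈A j y′⇝x) y∈ _ =
    incident-along y′⇝x y′∈ (l , x∈p∩q⁺ (l∈A , joins-induced j y∈ y′∈) , far-end j)
    where
    y′∈ = ∈-component⁺ (reach-trans (∈-component⁻ y∈) (step l l∈A j here))
    far-end : ∀ {x y} → Joins G l x y → src l ≡ y ⊎ tgt l ≡ y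
    far-end fwd = inj₂ refl
    far-end bwd = inj₁ refl

  vertexSet-componentEdges : ∀ {A z k} → k ∈ componentEdges A z →
                             vertexSet G (componentEdges A z) ≡ component A z
  vertexSet-componentEdges {A} {z} {k} k∈ = ⊆-antisym ⊆component component⊆
    where
    ⊆component : vertexSet G (componentEdges A z) ⊆ component A z
    ⊆component x∈ with to (∈-vertexSet {componentEdges A z}) x∈
    ... | l , l∈ , inj₁ refl = proj₁ (∈-induced⁻ (proj₂ (x∈p∩q⁻ A _ l∈)))
    ... | l , l∈ , inj₂ refl = proj₂ (∈-induced⁻ (proj₂ (x∈p∩q⁻ A _ l∈)))
    src-k∈ : src k ∈ component A z
    src-k∈ = proj₁ (∈-induced⁻ (proj₂ (x∈p∩q⁻ A _ k∈)))
    component⊆ : component A z ⊆ vertexSet G (componentEdges A z)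
    component⊆ x∈ = from (∈-vertexSet {componentEdges A z})
      (incident-along (reach-trans (reach-sym (∈-component⁻ src-k∈)) (∈-component⁻ x∈)) src-k∈
                      (k , k∈ , inj₁ refl))

module MonochromaticColourings {n : ℕ} (G : Graph n) where
  open import Data.Fin.Subset using (_∈_; _∉_)
  open import Data.Vec.Properties using (lookup∘tabulate; lookup-replicate)

  open Graph G
  open Connectivity G

  monochromatic : ∀ {q} → Vec (Fin q) n → EdgeSet G
  monochromatic κ = tabulate (λ k → does (lookup κ (src k) ≟ lookup κ (tgt k)))

  ∈-monochromatic : ∀ {q} (κ : Vec (Fin q) n) {k} → k ∈ monochromatic κ ⇔ lookup κ (src k) ≡ lookup κ (tgt k)
  ∈-monochromatic κ = ∈-tabulate-does (λ k → lookup κ (src k) ≟ lookup κ (tgt k))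

  #monochromatic : ℕ → EdgeSet G → ℤ
  #monochromatic q A = ∑[ κ ← allVecs q n ] 𝟙 (A ⊆? monochromatic κ)

  proper⇔monochromatic⊆⊥ : ∀ {q} {κ : Vec (Fin q) n} → Proper G κ ⇔ monochromatic κ ⊆ ⊥
  proper⇔monochromatic⊆⊥ {κ = κ} =
    mk⇔ (λ proper {k} k∈ → ⊥-elim (proper k (to (∈-monochromatic κ) k∈)))
        (λ mono⊆⊥ k same → ∉⊥ (mono⊆⊥ (from (∈-monochromatic κ) same)))

  chromatic-inclusion-exclusion : ∀ q →
    + chromatic G q ≡ ∑[ A ← subsets m ] (-1ℤ ^ℤ ∣ A ∣ * #monochromatic q A)
  chromatic-inclusion-exclusion q = begin
    + chromatic G q                                 ≡⟨ length-filter (proper? G) (allVecs q n) ⟩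
    ∑[ κ ← allVecs q n ] 𝟙 (proper? G κ)
      ≡⟨ ∑-cong (allVecs q n) (λ κ → 𝟙-cong (proper? G κ) (monochromatic κ ⊆? ⊥) (proper⇔monochromatic⊆⊥ {κ = κ})) ⟩
    ∑[ κ ← allVecs q n ] 𝟙 (monochromatic κ ⊆? ⊥)
      ≡⟨ ∑-cong (allVecs q n) (sym ∘ ∑-subsets-alternating ∘ monochromatic) ⟩
    ∑[ κ ← allVecs q n ] ∑[ A ← subsets m ] (-1ℤ ^ℤ ∣ A ∣ * 𝟙 (A ⊆? monochromatic κ))
      ≡⟨ ∑-comm (allVecs q n) (subsets m) _ ⟩
    ∑[ A ← subsets m ] ∑[ κ ← allVecs q n ] (-1ℤ ^ℤ ∣ A ∣ * 𝟙 (A ⊆? monochromatic κ))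
      ≡⟨ ∑-cong (subsets m) (λ A → ∑-*ˡ (allVecs q n) (-1ℤ ^ℤ ∣ A ∣) _) ⟩
    ∑[ A ← subsets m ] (-1ℤ ^ℤ ∣ A ∣ * #monochromatic q A)                  ∎
    where open ≡-Reasoning

  reach-monochromatic : ∀ {q} (κ : Vec (Fin q) n) {A x y} → A ⊆ monochromatic κ →
                        Reach G A x y → lookup κ x ≡ lookup κ y
  reach-monochromatic κ A⊆ here                  = refl
  reach-monochromatic κ A⊆ (step k k∈A fwd k⇝y) =
    trans (to (∈-monochromatic κ) (A⊆ k∈A)) (reach-monochromatic κ A⊆ k⇝y)
  reach-monochromatic κ A⊆ (step k k∈A bwd k⇝y) =
    trans (sym (to (∈-monochromatic κ) (A⊆ k∈A))) (reach-monochromatic κ A⊆ k⇝y)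

  #monochromatic-cong : ∀ q {A B} → (∀ {x y} → Reach G A x y → Reach G B x y) →
                        (∀ {x y} → Reach G B x y → Reach G A x y) → #monochromatic q A ≡ #monochromatic q B
  #monochromatic-cong q {A} {B} A⇒B B⇒A = ∑-cong (allVecs q n) λ κ →
    𝟙-cong (A ⊆? monochromatic κ) (B ⊆? monochromatic κ) (mk⇔ (transfer κ B⇒A) (transfer κ A⇒B))
    where
    transfer : ∀ κ {A B} → (∀ {x y} → Reach G B x y → Reach G A x y) →
               A ⊆ monochromatic κ → B ⊆ monochromatic κ
    transfer κ B⇒A A⊆ l∈B = from (∈-monochromatic κ) (reach-monochromatic κ A⊆ (B⇒A (reach-edge l∈B)))

  #monochromatic-⊥ : ∀ q → #monochromatic q ⊥ ≡ + (q ^ n)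
  #monochromatic-⊥ q = trans (∑-cong (allVecs q n) (λ κ → 𝟙-yes (⊥ ⊆? monochromatic κ) ⊥⊆)) (∑-allVecs-1 q n)

  module _ {q : ℕ} (C : Subset n) (π : Permutation′ q) where

    recolourOn : Fin n → Permutation′ q
    recolourOn i = if does (i ∈? C) then π else Perm.id

    lookup-recolourOn-∈ : ∀ κ {i} → i ∈ C → lookup (recolour recolourOn κ) i ≡ π ⟨$⟩ʳ lookup κ i
    lookup-recolourOn-∈ κ {i} i∈C rewrite lookup∘tabulate (λ j → recolourOn j ⟨$⟩ʳ lookup κ j) i
                                        | dec-true (i ∈? C) i∈C = refl

    lookup-recolourOn-∉ : ∀ κ {i} → i ∉ C → lookup (recolour recolourOn κ) i ≡ lookup κ i
    lookup-recolourOn-∉ κ {i} i∉C rewrite lookup∘tabulate (λ j → recolourOn j ⟨$⟩ʳ lookup κ j) i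
                                        | dec-false (i ∈? C) i∉C = refl

    recolourOn-monochromatic : ∀ {H} → (∀ {l} → l ∈ H → src l ∈ C ⇔ tgt l ∈ C) →
                               ∀ κ → H ⊆ monochromatic (recolour recolourOn κ) ⇔ H ⊆ monochromatic κ
    recolourOn-monochromatic {H} same-side κ = mk⇔ (λ H⊆ {l} l∈H → from (∈-monochromatic κ)
                                                     (to (same-colour l∈H) (to (∈-monochromatic κ′) (H⊆ l∈H))))
                                                   (λ H⊆ {l} l∈H → from (∈-monochromatic κ′)
                                                     (from (same-colour l∈H) (to (∈-monochromatic κ) (H⊆ l∈H))))
      where
      κ′ = recolour recolourOn κ
      same-colour : ∀ {l} → l ∈ H → lookup κ′ (src l) ≡ lookup κ′ (tgt l) ⇔ lookup κ (src l) ≡ lookup κ (tgt l)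
      same-colour {l} l∈H with src l ∈? C
      ... | yes s∈C rewrite lookup-recolourOn-∈ κ s∈C | lookup-recolourOn-∈ κ (to (same-side l∈H) s∈C) =
        mk⇔ (⟨$⟩ʳ-injective π) (cong (π ⟨$⟩ʳ_))
      ... | no s∉C rewrite lookup-recolourOn-∉ κ s∉C | lookup-recolourOn-∉ κ (s∉C ∘ from (same-side l∈H)) =
        mk⇔ id id

  -- Swapping two colours on the side of the bridge containing tgt k shows that every pair of
  -- colours of (src k , tgt k) is realised equally often; only the equal pairs extend to A.
  #monochromatic-bridge : ∀ q {A k} → k ∈ A → ¬ Reach G (A - k) (src k) (tgt k) →
                          #monochromatic q (A - k) ≡ + q * #monochromatic q A
  #monochromatic-bridge q {A} {k} k∈A bridge = begin
    ∑[ κ ← Vs ] M κ                                  ≡⟨ ∑-cong Vs split-colours ⟩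
    ∑[ κ ← Vs ] ∑[ a ← Cs ] ∑[ b ← Cs ] F a b κ       ≡⟨ ∑-comm Vs Cs _ ⟩
    ∑[ a ← Cs ] ∑[ κ ← Vs ] ∑[ b ← Cs ] F a b κ       ≡⟨ ∑-cong Cs (λ a → ∑-comm Vs Cs (λ κ b → F a b κ)) ⟩
    ∑[ a ← Cs ] ∑[ b ← Cs ] ∑[ κ ← Vs ] F a b κ       ≡⟨ ∑-cong Cs (λ a → ∑-cong Cs (swap-colours a)) ⟩
    ∑[ a ← Cs ] ∑[ b ← Cs ] ∑[ κ ← Vs ] F a a κ       ≡⟨ ∑-cong Cs (λ a → ∑-const Cs _) ⟩
    ∑[ a ← Cs ] (+ length Cs * ∑[ κ ← Vs ] F a a κ)  ≡⟨ ∑-*ˡ Cs (+ length Cs) (λ a → ∑[ κ ← Vs ] F a a κ) ⟩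
    + length Cs * ∑[ a ← Cs ] ∑[ κ ← Vs ] F a a κ    ≡⟨ cong₂ _*_ (cong +_ (List.length-tabulate {n = q} (λ a → a)))
                                                                  (∑-comm Cs Vs (λ a κ → F a a κ)) ⟩
    + q * ∑[ κ ← Vs ] ∑[ a ← Cs ] F a a κ            ≡⟨ cong (+ q *_) (∑-cong Vs same-colour) ⟩
    + q * #monochromatic q A                          ∎
    where
    open ≡-Reasoning
    H = A - k
    u = src k
    v = tgt k
    C = component H v
    Vs = allVecs q n
    Cs = allFin q
    M : Vec (Fin q) n → ℤ
    M κ = 𝟙 (H ⊆? monochromatic κ)
    F : Fin q → Fin q → Vec (Fin q) n → ℤ
    F a b κ = 𝟙 (lookup κ u ≟ a) * (𝟙 (lookup κ v ≟ b) * M κ)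

    split-colours : ∀ κ → M κ ≡ ∑[ a ← Cs ] ∑[ b ← Cs ] F a b κ
    split-colours κ = begin
      M κ                                      ≡⟨ ∑-allFin-𝟙 (lookup κ u) (λ _ → M κ) ⟨
      ∑[ a ← Cs ] (𝟙 (lookup κ u ≟ a) * M κ)
        ≡⟨ ∑-cong Cs (λ a → cong (𝟙 (lookup κ u ≟ a) *_) (∑-allFin-𝟙 (lookup κ v) (λ _ → M κ))) ⟨
      ∑[ a ← Cs ] (𝟙 (lookup κ u ≟ a) * ∑[ b ← Cs ] (𝟙 (lookup κ v ≟ b) * M κ))
        ≡⟨ ∑-cong Cs (λ a → ∑-*ˡ Cs (𝟙 (lookup κ u ≟ a)) (λ b → 𝟙 (lookup κ v ≟ b) * M κ)) ⟨
      ∑[ a ← Cs ] ∑[ b ← Cs ] F a b κ          ∎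

    same-colour : ∀ κ → ∑[ a ← Cs ] F a a κ ≡ 𝟙 (A ⊆? monochromatic κ)
    same-colour κ = begin
      ∑[ a ← Cs ] F a a κ                   ≡⟨ ∑-allFin-𝟙 (lookup κ u) (λ a → 𝟙 (lookup κ v ≟ a) * M κ) ⟩
      𝟙 (lookup κ v ≟ lookup κ u) * M κ     ≡⟨ 𝟙-× (lookup κ v ≟ lookup κ u) (H ⊆? monochromatic κ) ⟨
      𝟙 (lookup κ v ≟ lookup κ u ×-dec H ⊆? monochromatic κ)
        ≡⟨ 𝟙-cong (lookup κ v ≟ lookup κ u ×-dec H ⊆? monochromatic κ) (A ⊆? monochromatic κ) (mk⇔ join split) ⟩
      𝟙 (A ⊆? monochromatic κ)              ∎
      where
      split : A ⊆ monochromatic κ → lookup κ v ≡ lookup κ u × H ⊆ monochromatic κ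
      split A⊆ = sym (to (∈-monochromatic κ) (A⊆ k∈A)) , A⊆ ∘ proj₁ ∘ x∈p-y⇒x∈p∧x≢y
      join : lookup κ v ≡ lookup κ u × H ⊆ monochromatic κ → A ⊆ monochromatic κ
      join (same , H⊆) {l} l∈A with l ≟ k
      ... | yes refl = from (∈-monochromatic κ) (sym same)
      ... | no l≢k   = H⊆ (x∈p∧x≢y⇒x∈p-y l∈A l≢k)

    u∉C : u ∉ C
    u∉C u∈C = bridge (reach-sym (∈-component⁻ u∈C))

    same-side : ∀ {l} → l ∈ H → src l ∈ C ⇔ tgt l ∈ C
    same-side l∈H = mk⇔ (λ s∈C → ∈-component⁺ (reach-trans (∈-component⁻ s∈C) (reach-edge l∈H)))
                        (λ t∈C → ∈-component⁺ (reach-trans (∈-component⁻ t∈C) (reach-sym (reach-edge l∈H))))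

    swap-colours : ∀ a b → ∑[ κ ← Vs ] F a b κ ≡ ∑[ κ ← Vs ] F a a κ
    swap-colours a b = trans (sym (∑-allVecs-recolour (recolourOn C τ) (F a b))) (∑-cong Vs F-recolour)
      where
      τ = transpose a b
      swapped : Vec (Fin q) n → Vec (Fin q) n
      swapped = recolour (recolourOn C τ)
      F-recolour : ∀ κ → F a b (swapped κ) ≡ F a a κ
      F-recolour κ = cong₂ _*_ (cong (λ c → 𝟙 (c ≟ a)) (lookup-recolourOn-∉ C τ κ u∉C)) (cong₂ _*_
        (trans (cong (λ c → 𝟙 (c ≟ b)) (lookup-recolourOn-∈ C τ κ (∈-component⁺ here)))
               (𝟙-permute τ {a} {b} {lookup κ v} (transpose-maps a b)))
        (𝟙-cong (H ⊆? monochromatic (swapped κ)) (H ⊆? monochromatic κ) (recolourOn-monochromatic C τ same-side κ)))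

  #monochromatic-forest-* : ∀ q {A} → Acyclic G A → #monochromatic q A * + (q ^ ∣ A ∣) ≡ + (q ^ n)
  #monochromatic-forest-* q {A} = count ∣ A ∣ refl
    where
    count : ∀ c {A} → ∣ A ∣ ≡ c → Acyclic G A → #monochromatic q A * + (q ^ c) ≡ + (q ^ n)
    count zero {A} ∣A∣≡0 _ with nonempty? A
    ... | yes (k , k∈A) = ⊥-elim (ℕ.1+n≢0 (trans (suc∣p-x∣≡∣p∣ k∈A) ∣A∣≡0))
    ... | no empty rewrite Empty-unique empty = trans (ℤ.*-identityʳ _) (#monochromatic-⊥ q)
    count (suc c) {A} ∣A∣≡1+c acyclic with nonempty? A
    ... | no empty = ⊥-elim (ℕ.0≢1+n (trans (sym (∣⊥∣≡0 m)) (subst (λ p → ∣ p ∣ ≡ suc c) (Empty-unique empty) ∣A∣≡1+c)))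
    ... | yes (k , k∈A) = begin
      #monochromatic q A * + (q ^ suc c)          ≡⟨ cong (#monochromatic q A *_) (ℤ.pos-* q (q ^ c)) ⟩
      #monochromatic q A * (+ q * + (q ^ c))      ≡⟨ a*[b*c]≡[b*a]*c (#monochromatic q A) (+ q) (+ (q ^ c)) ⟩
      (+ q * #monochromatic q A) * + (q ^ c)
        ≡⟨ cong (_* + (q ^ c)) (#monochromatic-bridge q k∈A (acyclic k k∈A)) ⟨
      #monochromatic q (A - k) * + (q ^ c)
        ≡⟨ count c (ℕ.suc-injective (trans (suc∣p-x∣≡∣p∣ k∈A) ∣A∣≡1+c)) (acyclic-mono {A - k} (proj₁ ∘ x∈p-y⇒x∈p∧x≢y) acyclic) ⟩
      + (q ^ n)                                   ∎
      where
      open ≡-Reasoning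
      a*[b*c]≡[b*a]*c : ∀ a b c → a * (b * c) ≡ (b * a) * c
      a*[b*c]≡[b*a]*c = solve-∀

  -- With two colours a forest has at least the two constant colourings, so 2 · 2 ^ ∣ A ∣ ≤ 2 ^ n.
  forest-size : ∀ {A} → Acyclic G A → 0 < n → ∣ A ∣ < n
  forest-size {A} acyclic 0<n =
    ℕ.≮⇒≥ (λ n<1+∣A∣ → ℕ.<⇒≱ (ℕ.^-monoʳ-< 2 (s≤s (s≤s z≤n)) n<1+∣A∣) 2^[1+∣A∣]≤2^n)
    where
    N = length (filter (λ κ → A ⊆? monochromatic κ) (allVecs 2 n))
    N*2^∣A∣≡2^n : N ℕ.* 2 ^ ∣ A ∣ ≡ 2 ^ n
    N*2^∣A∣≡2^n = ℤ.+-injective (begin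
      + (N ℕ.* 2 ^ ∣ A ∣)                 ≡⟨ ℤ.pos-* N (2 ^ ∣ A ∣) ⟩
      + N * + (2 ^ ∣ A ∣)
        ≡⟨ cong (_* + (2 ^ ∣ A ∣)) (length-filter (λ κ → A ⊆? monochromatic κ) (allVecs 2 n)) ⟩
      #monochromatic 2 A * + (2 ^ ∣ A ∣)  ≡⟨ #monochromatic-forest-* 2 acyclic ⟩
      + (2 ^ n)                           ∎)
      where open ≡-Reasoning
    constant : ∀ c → A ⊆ monochromatic (replicate n c)
    constant c {k} _ =
      from (∈-monochromatic (replicate n c)) (trans (lookup-replicate (src k) c) (sym (lookup-replicate (tgt k) c)))
    2^[1+∣A∣]≤2^n : 2 ^ suc ∣ A ∣ ≤ 2 ^ n
    2^[1+∣A∣]≤2^n = begin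
      2 ℕ.* 2 ^ ∣ A ∣  ≤⟨ ℕ.*-monoˡ-≤ (2 ^ ∣ A ∣) (two-constant-colourings 0<n (λ κ → A ⊆? monochromatic κ) constant) ⟩
      N ℕ.* 2 ^ ∣ A ∣  ≡⟨ N*2^∣A∣≡2^n ⟩
      2 ^ n            ∎
      where open ℕ.≤-Reasoning

  #monochromatic-forest : ∀ q {A} → Acyclic G A → #monochromatic q A ≡ + (q ^ (n ∸ ∣ A ∣))
  #monochromatic-forest q {A} acyclic with nonempty? A
  ... | no empty rewrite Empty-unique empty | ∣⊥∣≡0 m = #monochromatic-⊥ q
  ... | yes (k , _) = by-colours q
    where
    ∣A∣<n : ∣ A ∣ < n
    ∣A∣<n = forest-size acyclic (ℕ.≤-<-trans z≤n (Fin.toℕ<n (src k)))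
    by-colours : ∀ q → #monochromatic q A ≡ + (q ^ (n ∸ ∣ A ∣))
    by-colours zero = trans (cong (λ κs → ∑[ κ ← κs ] 𝟙 (A ⊆? monochromatic κ)) (allVecs-0 (ℕ.≤-<-trans z≤n ∣A∣<n)))
                            (cong +_ (sym (0^-pos (ℕ.m<n⇒0<n∸m ∣A∣<n))))
      where
      0^-pos : ∀ {d} → 0 < d → 0 ^ d ≡ 0
      0^-pos {suc d} _ = refl
    by-colours q@(suc _) = ℤ.*-cancelʳ-≡ _ _ (+ (q ^ ∣ A ∣)) {{ℕ.m^n≢0 q ∣ A ∣}} (begin
      #monochromatic q A * + (q ^ ∣ A ∣)          ≡⟨ #monochromatic-forest-* q acyclic ⟩
      + (q ^ n)                                   ≡⟨ cong (λ d → + (q ^ d)) (ℕ.m∸n+n≡m (ℕ.<⇒≤ ∣A∣<n)) ⟨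
      + (q ^ (n ∸ ∣ A ∣ ℕ.+ ∣ A ∣))               ≡⟨ cong +_ (ℕ.^-distribˡ-+-* q (n ∸ ∣ A ∣) ∣ A ∣) ⟩
      + (q ^ (n ∸ ∣ A ∣) ℕ.* q ^ ∣ A ∣)           ≡⟨ ℤ.pos-* (q ^ (n ∸ ∣ A ∣)) (q ^ ∣ A ∣) ⟩
      + (q ^ (n ∸ ∣ A ∣)) * + (q ^ ∣ A ∣)         ∎)
      where open ≡-Reasoning

module SwitchingInvolution {n : ℕ} (G : Graph n) (𝐦 : Subset n → EdgeSet G → EdgeSet G)
                           (scheme : IsPartitionSchemeG G 𝐦) where
  open import Data.Fin.Subset using (_∈_; _∉_)

  open Graph G
  open Connectivity G
  open MonochromaticColourings G

  module _ {R : Subset n} (R∈C : InC G R) where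

    𝐦-⊇ : ∀ {τ} → SpanningTree G R τ → τ ⊆ 𝐦 R τ
    𝐦-⊇ τ-spanning = proj₁ (proj₁ (scheme R R∈C) _ τ-spanning)

    𝐦-⊆-induced : ∀ {τ} → SpanningTree G R τ → 𝐦 R τ ⊆ induced G R
    𝐦-⊆-induced τ-spanning = proj₁ (proj₂ (proj₁ (scheme R R∈C) _ τ-spanning))

    module _ {g : EdgeSet G} (g-conn : ConnSpanning G R g) where

      treeOf : EdgeSet G
      treeOf = proj₁ (proj₁ (proj₂ (scheme R R∈C)) g g-conn)

      treeOf-spanning : SpanningTree G R treeOf
      treeOf-spanning = proj₁ (proj₂ (proj₁ (proj₂ (scheme R R∈C)) g g-conn))

      treeOf-⊆ : treeOf ⊆ g
      treeOf-⊆ = proj₁ (proj₂ (proj₂ (proj₁ (proj₂ (scheme R R∈C)) g g-conn)))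

      ⊆-𝐦-treeOf : g ⊆ 𝐦 R treeOf
      ⊆-𝐦-treeOf = proj₂ (proj₂ (proj₂ (proj₁ (proj₂ (scheme R R∈C)) g g-conn)))

      treeOf-unique : ∀ {τ} → SpanningTree G R τ → τ ⊆ g → g ⊆ 𝐦 R τ → τ ≡ treeOf
      treeOf-unique τ-spanning τ⊆g g⊆𝐦τ =
        proj₂ (proj₂ (scheme R R∈C)) g _ _ g-conn τ-spanning treeOf-spanning τ⊆g g⊆𝐦τ treeOf-⊆ ⊆-𝐦-treeOf

  record SwitchableIn (A : EdgeSet G) (R : Subset n) (e : Fin m) : Set where
    field
      inside   : e ∈ induced G R
      tree     : EdgeSet G
      spanning : SpanningTree G R tree
      tree-⊆   : tree ⊆ A ∩ induced G R
      ⊆-𝐦      : A ∩ induced G R ⊆ 𝐦 R tree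
      ∈-𝐦      : e ∈ 𝐦 R tree
      ∉-tree   : e ∉ tree

  Switchable : EdgeSet G → Fin m → Set
  Switchable A e = SwitchableIn A (component A (src e)) e

  tree-unique : ∀ {A z e f} (s : SwitchableIn A (component A z) e) (t : SwitchableIn A (component A z) f) →
                SwitchableIn.tree s ≡ SwitchableIn.tree t
  tree-unique {A} {z} s t = trans (unique s) (sym (unique t))
    where
    R∈C = component-InC (SwitchableIn.inside s)
    unique : ∀ {f} (t : SwitchableIn A (component A z) f) →
             SwitchableIn.tree t ≡ treeOf R∈C (component-connected A z)
    unique t = treeOf-unique R∈C (component-connected A z) spanning tree-⊆ ⊆-𝐦
      where open SwitchableIn t

  switchable? : ∀ A e → Dec (Switchable A e)
  switchable? A e with e ∈? induced G (component A (src e))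
  ... | no  e∉R = no (e∉R ∘ SwitchableIn.inside)
  ... | yes e∈R = Dec.map (mk⇔ build (λ s → subst (e ∈_) (cong (𝐦 R) (canonical s)) (SwitchableIn.∈-𝐦 s)
                                           , subst (e ∉_) (canonical s) (SwitchableIn.∉-tree s)))
                          (e ∈? 𝐦 R τ₀ ×-dec ¬? (e ∈? τ₀))
    where
    R = component A (src e)
    R∈C = component-InC e∈R
    τ₀ = treeOf R∈C (component-connected A (src e))
    canonical : (s : Switchable A e) → SwitchableIn.tree s ≡ τ₀
    canonical s = treeOf-unique R∈C (component-connected A (src e)) spanning tree-⊆ ⊆-𝐦
      where open SwitchableIn s
    build : e ∈ 𝐦 R τ₀ × e ∉ τ₀ → Switchable A e
    build (e∈𝐦 , e∉τ₀) = record
      { inside = e∈R ; tree = τ₀ ; spanning = treeOf-spanning R∈C _ ; tree-⊆ = treeOf-⊆ R∈C _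
      ; ⊆-𝐦 = ⊆-𝐦-treeOf R∈C _ ; ∈-𝐦 = e∈𝐦 ; ∉-tree = e∉τ₀ }

  -- Switching an edge e of A does not change which edges are switchable: the ends of e are
  -- joined by the tree of its component, so A and B have the same components, and the edges
  -- of every component stay in the same interval of the partition scheme.
  module Transfer {A B : EdgeSet G} {e : Fin m} (agree : ∀ {l} → l ≢ e → l ∈ A ⇔ l ∈ B)
                  (s : Switchable A e) where
    open SwitchableIn s

    private
      tree⊆A : tree ⊆ A
      tree⊆A = proj₁ ∘ x∈p∩q⁻ A _ ∘ tree-⊆

      tree⊆B : tree ⊆ B
      tree⊆B l∈τ = to (agree (λ { refl → ∉-tree l∈τ })) (tree⊆A l∈τ)

      bypass : Reach G tree (src e) (tgt e)
      bypass = proj₂ (proj₁ spanning) _ _ (proj₁ (∈-induced⁻ inside)) (proj₂ (∈-induced⁻ inside))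

      reach-via-tree : ∀ {H₁ H₂ x y} → tree ⊆ H₂ → (∀ {l} → l ≢ e → l ∈ H₁ → l ∈ H₂) →
                       Reach G H₁ x y → Reach G H₂ x y
      reach-via-tree {H₁} {H₂} tree⊆H₂ others = reach-map edge
        where
        edge : ∀ {l} → l ∈ H₁ → Reach G H₂ (src l) (tgt l)
        edge {l} l∈H₁ with l ≟ e
        ... | yes refl = reach-mono tree⊆H₂ bypass
        ... | no  l≢e  = reach-edge (others l≢e l∈H₁)

    reach-A⇒B : ∀ {x y} → Reach G A x y → Reach G B x y
    reach-A⇒B = reach-via-tree tree⊆B (to ∘ agree)

    reach-B⇒A : ∀ {x y} → Reach G B x y → Reach G A x y
    reach-B⇒A = reach-via-tree tree⊆A (from ∘ agree)

    switchable-transfer : ∀ {f} → Switchable A f → Switchable B f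
    switchable-transfer {f} t = subst (λ R′ → SwitchableIn B R′ f) (component-cong reach-A⇒B reach-B⇒A (src f)) record
      { inside = t.inside ; tree = t.tree ; spanning = t.spanning ; tree-⊆ = tree-⊆B ; ⊆-𝐦 = ⊆-𝐦B
      ; ∈-𝐦 = t.∈-𝐦 ; ∉-tree = t.∉-tree }
      where
      module t = SwitchableIn t
      R = component A (src f)
      e-inside : e ∈ induced G R → e ∈ 𝐦 R t.tree × e ∉ t.tree
      e-inside e∈R =
        subst (λ τ → e ∈ 𝐦 R τ × e ∉ τ) (tree-unique s′ t) (SwitchableIn.∈-𝐦 s′ , SwitchableIn.∉-tree s′)
        where
        s′ : SwitchableIn A R e
        s′ = subst (λ R′ → SwitchableIn A R′ e) (component-≡ (∈-component⁻ (proj₁ (∈-induced⁻ e∈R)))) s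
      tree-⊆B : t.tree ⊆ B ∩ induced G R
      tree-⊆B {l} l∈τ with l ≟ e | x∈p∩q⁻ A _ (t.tree-⊆ l∈τ)
      ... | yes refl | _          , l∈R = ⊥-elim (proj₂ (e-inside l∈R) l∈τ)
      ... | no  l≢e  | l∈A , l∈R = x∈p∩q⁺ (to (agree l≢e) l∈A , l∈R)
      ⊆-𝐦B : B ∩ induced G R ⊆ 𝐦 R t.tree
      ⊆-𝐦B {l} l∈ with l ≟ e | x∈p∩q⁻ B _ l∈
      ... | yes refl | _          , l∈R = proj₁ (e-inside l∈R)
      ... | no  l≢e  | l∈B , l∈R = t.⊆-𝐦 (x∈p∩q⁺ (from (agree l≢e) l∈B , l∈R))

  switchable-toggle : ∀ {A e f} → Switchable A e → Switchable (toggle A e) f ⇔ Switchable A f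
  switchable-toggle {A} {e} s = mk⇔ (Transfer.switchable-transfer (⇔-sym ∘ agree) s′)
                                    (Transfer.switchable-transfer agree s)
    where
    agree : ∀ {l} → l ≢ e → l ∈ A ⇔ l ∈ toggle A e
    agree l≢e = ⇔-sym (∈-toggle-≢ A l≢e)
    s′ : Switchable (toggle A e) e
    s′ = Transfer.switchable-transfer agree s s

  switchableSet : EdgeSet G → EdgeSet G
  switchableSet A = tabulate (λ e → does (switchable? A e))

  ∈-switchableSet : ∀ A {e} → e ∈ switchableSet A ⇔ Switchable A e
  ∈-switchableSet A = ∈-tabulate-does (switchable? A)

  switchableSet-toggle : ∀ {A e} → Switchable A e → switchableSet (toggle A e) ≡ switchableSet A
  switchableSet-toggle {A} {e} s = ⊆-antisym
    (from (∈-switchableSet A) ∘ to (switchable-toggle s) ∘ to (∈-switchableSet (toggle A e)))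
    (from (∈-switchableSet (toggle A e)) ∘ from (switchable-toggle s) ∘ to (∈-switchableSet A))

  switchWith : ∀ {S : EdgeSet G} → EdgeSet G → Dec (Nonempty S) → EdgeSet G
  switchWith A (yes (e , _)) = toggle A e
  switchWith A (no _)        = A

  -- The edge is read off the Boolean vector switchableSet A alone; switching it leaves that vector
  -- unchanged, so switching again picks the same edge.
  switch : EdgeSet G → EdgeSet G
  switch A = switchWith A (nonempty? (switchableSet A))

  switch-involutive : ∀ A → switch (switch A) ≡ A
  switch-involutive A = by-cases (nonempty? (switchableSet A)) refl
    where
    by-cases : (d : Dec (Nonempty (switchableSet A))) → nonempty? (switchableSet A) ≡ d →
               switch (switchWith A d) ≡ A
    by-cases (no _)          eq = cong (switchWith A) eq
    by-cases (yes (e , e∈S)) eq = begin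
      switch (toggle A e)
        ≡⟨ cong (switchWith (toggle A e) ∘ nonempty?) (switchableSet-toggle s) ⟩
      switchWith (toggle A e) (nonempty? (switchableSet A)) ≡⟨ cong (switchWith (toggle A e)) eq ⟩
      toggle (toggle A e) e                                 ≡⟨ toggle-involutive A e ⟩
      A                                                     ∎
      where
      open ≡-Reasoning
      s = to (∈-switchableSet A) e∈S

  NoSwitchable : EdgeSet G → Set
  NoSwitchable A = ∀ e → ¬ Switchable A e

  noSwitchable? : ∀ A → Dec (NoSwitchable A)
  noSwitchable? A = Fin.all? (λ e → ¬? (switchable? A e))

  switch-fixed : ∀ A → NoSwitchable A → switch A ≡ A
  switch-fixed A none with nonempty? (switchableSet A)
  ... | yes (e , e∈S) = ⊥-elim (none e (to (∈-switchableSet A) e∈S))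
  ... | no _          = refl

  signedCount : ℕ → EdgeSet G → ℤ
  signedCount q A = -1ℤ ^ℤ ∣ A ∣ * #monochromatic q A

  switch-reverses-sign : ∀ q A → ¬ NoSwitchable A → signedCount q (switch A) ≡ - signedCount q A
  switch-reverses-sign q A some with nonempty? (switchableSet A)
  ... | no ¬some      = ⊥-elim (some (λ e s → ¬some (e , from (∈-switchableSet A) s)))
  ... | yes (e , e∈S) = begin
    -1ℤ ^ℤ ∣ toggle A e ∣ * #monochromatic q (toggle A e)
      ≡⟨ cong₂ _*_ (sign-toggle A e) (#monochromatic-cong q (Transfer.reach-B⇒A agree s) (Transfer.reach-A⇒B agree s)) ⟩
    - (-1ℤ ^ℤ ∣ A ∣) * #monochromatic q A
      ≡⟨ ℤ.neg-distribˡ-* (-1ℤ ^ℤ ∣ A ∣) (#monochromatic q A) ⟨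
    - (-1ℤ ^ℤ ∣ A ∣ * #monochromatic q A)
      ∎
    where
    open ≡-Reasoning
    s = to (∈-switchableSet A) e∈S
    agree : ∀ {l} → l ≢ e → l ∈ A ⇔ l ∈ toggle A e
    agree l≢e = ⇔-sym (∈-toggle-≢ A l≢e)

  ∑-signedCount-noSwitchable : ∀ q → ∑ (subsets m) (signedCount q) ≡ ∑ (filter noSwitchable? (subsets m)) (signedCount q)
  ∑-signedCount-noSwitchable q =
    ∑-sign-reversing-involution (subsets-unique m) ∈-subsets switch switch-involutive
                                noSwitchable? switch-fixed (signedCount q) (switch-reverses-sign q)

  family⇒noSwitchable : ∀ {A} → InFamily G 𝐦 A → NoSwitchable A
  family⇒noSwitchable {A} (acyclic , trees) e s =
    ∉-tree (tree-⊇ (subst (e ∈_) 𝐦g≡g (subst (λ τ → e ∈ 𝐦 R τ) tree≡g ∈-𝐦)))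
    where
    open SwitchableIn s
    R = component A (src e)
    g = componentEdges A (src e)
    g-conn = component-connected A (src e)
    some-edge : ∃[ k ] k ∈ g
    some-edge = reach-some-edge (proj₂ g-conn _ _ (proj₁ (∈-induced⁻ inside)) (proj₂ (∈-induced⁻ inside))) (src≢tgt e)
    𝐦g≡g : 𝐦 R g ≡ g
    𝐦g≡g = subst (λ V → 𝐦 V g ≡ g) (vertexSet-componentEdges (proj₂ some-edge))
                 (trees g (componentEdges-Component (proj₂ some-edge)))
    tree-⊇ : g ⊆ tree
    tree-⊇ = spanning-tree-maximal spanning tree-⊆ (proj₁ g-conn) (acyclic-mono (proj₁ ∘ x∈p∩q⁻ A _) acyclic)
    tree≡g : tree ≡ g
    tree≡g = ⊆-antisym tree-⊆ tree-⊇

  module _ {A : EdgeSet G} (none : NoSwitchable A) where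

    componentEdges-tree : ∀ {z} (R∈C : InC G (component A z)) →
                          componentEdges A z ≡ treeOf R∈C (component-connected A z)
                          × 𝐦 (component A z) (componentEdges A z) ≡ componentEdges A z
    componentEdges-tree {z} R∈C =
      g≡τ₀ , subst (λ τ → 𝐦 R τ ≡ τ) (sym g≡τ₀) (⊆-antisym 𝐦τ₀⊆τ₀ (𝐦-⊇ R∈C τ₀-spanning))
      where
      R = component A z
      g-conn = component-connected A z
      τ₀ = treeOf R∈C g-conn
      τ₀-spanning = treeOf-spanning R∈C g-conn
      𝐦τ₀⊆τ₀ : 𝐦 R τ₀ ⊆ τ₀
      𝐦τ₀⊆τ₀ {l} l∈𝐦 with l ∈? τ₀
      ... | yes l∈τ₀ = l∈τ₀
      ... | no  l∉τ₀ = ⊥-elim (none l (subst (λ R′ → SwitchableIn A R′ l) same-component record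
        { inside = l∈R ; tree = τ₀ ; spanning = τ₀-spanning ; tree-⊆ = treeOf-⊆ R∈C g-conn
        ; ⊆-𝐦 = ⊆-𝐦-treeOf R∈C g-conn ; ∈-𝐦 = l∈𝐦 ; ∉-tree = l∉τ₀ }))
        where
        l∈R = 𝐦-⊆-induced R∈C τ₀-spanning l∈𝐦
        same-component = sym (component-≡ (∈-component⁻ (proj₁ (∈-induced⁻ l∈R))))
      g≡τ₀ : componentEdges A z ≡ τ₀
      g≡τ₀ = ⊆-antisym (𝐦τ₀⊆τ₀ ∘ ⊆-𝐦-treeOf R∈C g-conn) (treeOf-⊆ R∈C g-conn)

    noSwitchable-acyclic : Acyclic G A
    noSwitchable-acyclic k k∈A cycle =
      g-acyclic k k∈g (reach-mono within-g-k (reach-restrict (proj₁ ∘ x∈p-y⇒x∈p∧x≢y) cycle (∈-component⁺ here)))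
      where
      g = componentEdges A (src k)
      k∈g : k ∈ g
      k∈g = x∈p∩q⁺ (k∈A , ∈-induced⁺ (∈-component⁺ here) (∈-component⁺ (reach-edge k∈A)))
      R∈C = component-InC (proj₂ (x∈p∩q⁻ A _ k∈g))
      g-acyclic : Acyclic G g
      g-acyclic = subst (Acyclic G) (sym (proj₁ (componentEdges-tree R∈C)))
                        (proj₂ (treeOf-spanning R∈C (component-connected A (src k))))
      within-g-k : (A - k) ∩ induced G (component A (src k)) ⊆ g - k
      within-g-k l∈ with x∈p∩q⁻ (A - k) _ l∈
      ... | l∈A-k , l∈R = x∈p∧x≢y⇒x∈p-y (x∈p∩q⁺ (proj₁ (x∈p-y⇒x∈p∧x≢y l∈A-k) , l∈R)) (proj₂ (x∈p-y⇒x∈p∧x≢y l∈A-k))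

    noSwitchable-trees : ∀ τ → Component G A τ → 𝐦 (vertexSet G τ) τ ≡ τ
    noSwitchable-trees τ c@(k , k∈τ , _) = subst (λ τ → 𝐦 (vertexSet G τ) τ ≡ τ) (sym τ≡g)
      (subst (λ V → 𝐦 V g ≡ g) (sym (vertexSet-componentEdges k∈g))
             (proj₂ (componentEdges-tree (component-InC (proj₂ (x∈p∩q⁻ A _ k∈g))))))
      where
      g = componentEdges A (src k)
      τ≡g : τ ≡ g
      τ≡g = Component-≡ c
      k∈g : k ∈ g
      k∈g = subst (k ∈_) τ≡g k∈τ

  noSwitchable⇔family : ∀ {A} → NoSwitchable A ⇔ InFamily G 𝐦 A
  noSwitchable⇔family = mk⇔ (λ none → noSwitchable-acyclic none , noSwitchable-trees none) family⇒noSwitchable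

open import Data.List.Membership.Propositional using (_∈_)
open import Data.List.Membership.Propositional.Properties using (∈-filter⁺; ∈-filter⁻)

theorem2 : ∀ {n} (G : Graph n) (𝐦 : Subset n → Subset (Graph.m G) → Subset (Graph.m G)) →
    IsPartitionSchemeG G 𝐦 →
    (Fs : List (Subset (Graph.m G))) → Unique Fs →
    (∀ F → (F ∈ Fs → InFamily G 𝐦 F) × (InFamily G 𝐦 F → F ∈ Fs)) →
    ∀ (q : ℕ) → + chromatic G q ≡ sumℤ (map (λ F → (-1ℤ ^ℤ ∣ F ∣) * + (q ^ (n ∸ ∣ F ∣))) Fs)
theorem2 {n} G 𝐦 scheme Fs unique-Fs Fs-family q = begin
  + chromatic G q                                          ≡⟨ chromatic-inclusion-exclusion q ⟩
  ∑ (subsets m) (signedCount q)                            ≡⟨ ∑-signedCount-noSwitchable q ⟩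
  ∑ (filter noSwitchable? (subsets m)) (signedCount q)
    ≡⟨ ∑-same-elements (Unique.filter⁺ noSwitchable? (subsets-unique m)) unique-Fs (mk⇔ to-Fs from-Fs) (signedCount q) ⟩
  ∑ Fs (signedCount q)
    ≡⟨ ∑-cong-∈ Fs (λ F F∈Fs → cong (-1ℤ ^ℤ ∣ F ∣ *_) (#monochromatic-forest q (proj₁ (proj₁ (Fs-family F) F∈Fs)))) ⟩
  sumℤ (map (λ F → (-1ℤ ^ℤ ∣ F ∣) * + (q ^ (n ∸ ∣ F ∣))) Fs) ∎
  where
  open ≡-Reasoning
  open Graph G
  open MonochromaticColourings G
  open SwitchingInvolution G 𝐦 scheme
  to-Fs : ∀ {A} → A ∈ filter noSwitchable? (subsets m) → A ∈ Fs
  to-Fs {A} A∈ = proj₂ (Fs-family A) (to noSwitchable⇔family (proj₂ (∈-filter⁻ noSwitchable? {xs = subsets m} A∈)))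
  from-Fs : ∀ {A} → A ∈ Fs → A ∈ filter noSwitchable? (subsets m)
  from-Fs {A} A∈ = ∈-filter⁺ noSwitchable? (∈-subsets A) (from noSwitchable⇔family (proj₁ (Fs-family A) A∈))
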